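{- Let $\ell= \lfloor \frac{n-1}{2} \rfloor$. For any monomial $y^\delta$, the remainder $\overline{y^\delta}^{F_\ell}$ of $y^\delta$ on division by $F_\ell$ is a $K$-linear combination of elements of $B=\{y^\gamma : y^\gamma \text{ square free and } \gamma \text{ stays weakly above the diagonal}\}$. In particular, $B$ spans $R/I$, where $I=\langle y_1+\cdots+y_n, y_1^2,\dots,y_n^2\rangle$.
   Context: Let $K$ be a field of characteristic $0$, $R=K[y_1,\dots,y_n]$, lexicographic order $y_1>\cdots>y_n$. A square-free monomial $y^\gamma$ is identified with its bitstring $\gamma\in\{0,1\}^n$ and with the northeast lattice path whose $i$-th step is north if $\gamma_i=0$ and east if $\gamma_i=1$; $\gamma$ stays above the diagonal if every prefix of $\gamma$ has at least as many zeros as ones. An MCP (Modified Catalan Path) is $\alpha=w\,1\,0^m\in\{0,1\}^n$ where $w\in\{0,1\}^{2l}$ has $l$ zeros and $l$ ones and stays above the diagonal; $\ell_1(\alpha)$ is the number of ones. $P_\alpha=\{\beta\in\{0,1\}^n:\beta\neq\alpha,\ \ell_1(\beta)=\ell_1(\alpha),\ \alpha_i=0\Rightarrow\beta_i=0 \text{ for } 1\le i\le 2\ell_1(\alpha)-1\}$, $g_\alpha=y^\alpha+\sum_{\beta\in P_\alpha}y^\beta$, and $F_\ell=\{y_2^2,\dots,y_n^2\}\cup\{g_\alpha:\alpha \text{ an MCP of length } n,\ \ell_1(\alpha)-1\le\ell\}$. It was shown earlier that $\langle F_\ell\rangle = I$ for this $\ell$ (for $n\ge3$). -}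

module Defs where

open import Level using (Level; _⊔_) renaming (suc to lsuc)
open import Algebra.Bundles using (CommutativeRing)
open import Data.Bool using (Bool; true; false; if_then_else_)
import Data.Bool.Properties as BoolP
open import Data.Nat using (ℕ; zero; suc; _≤_; _<_; _≥_; _∸_; _≤?_) renaming (_*_ to _*ℕ_)
import Data.Nat.Properties as ℕP
open import Data.Fin using (Fin; toℕ)
open import Data.Fin.Properties using (all?)
open import Data.List using (List; []; _∷_; _++_; take; filter; allFin; foldr)
import Data.List as List
open import Data.Vec using (Vec; []; _∷_; lookup; toList; zipWith; _[_]≔_)
import Data.Vec as Vec
open import Data.Vec.Properties using (≡-dec)
open import Data.Vec.Relation.Binary.Pointwise.Inductive using (Pointwise)
import Data.Vec.Relation.Binary.Pointwise.Inductive as PW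
open import Data.Product using (Σ; ∃; ∃-syntax; _×_; _,_)
import Data.Product
open import Data.Sum using (_⊎_)
open import Data.Empty using (⊥)
open import Relation.Nullary using (¬_; Dec; does; ¬?)
open import Relation.Nullary.Decidable using (_×-dec_; _→-dec_)
open import Relation.Binary.PropositionalEquality using (_≡_; _≢_)
open import Relation.Binary.Construct.Closure.ReflexiveTransitive using (Star)

record Field (c ℓ : Level) : Set (lsuc (c ⊔ ℓ)) where
  field
    commutativeRing : CommutativeRing c ℓ
  open CommutativeRing commutativeRing public
  field
    1≉0 : ¬ (1# ≈ 0#)
    inverse : ∀ x → ¬ (x ≈ 0#) → ∃[ y ] (x * y ≈ 1#)

module _ {c ℓ} (K : Field c ℓ) where
  open Field K
  natK : ℕ → Carrier
  natK zero = 0#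
  natK (suc k) = 1# + natK k

  CharZero : Set ℓ
  CharZero = ∀ k → ¬ (natK (suc k) ≈ 0#)

zeros : List Bool → ℕ
zeros [] = 0
zeros (false ∷ xs) = suc (zeros xs)
zeros (true ∷ xs) = zeros xs

ones : List Bool → ℕ
ones [] = 0
ones (false ∷ xs) = ones xs
ones (true ∷ xs) = suc (ones xs)

StaysAbove : List Bool → Set
StaysAbove w = ∀ k → ones (take k w) ≤ zeros (take k w)

replicateL : ℕ → Bool → List Bool
replicateL zero b = []
replicateL (suc m) b = b ∷ replicateL m b

allBits : (k : ℕ) → List (Vec Bool k)
allBits zero = [] ∷ []
allBits (suc k) = List.map (false ∷_) (allBits k) List.++ List.map (true ∷_) (allBits k)

-- lexicographic order on exponent vectors, y₁ (index 0) most significant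
_<L_ : ∀ {k} → Vec ℕ k → Vec ℕ k → Set
[] <L [] = ⊥
(x ∷ xs) <L (y ∷ ys) = x < y ⊎ (x ≡ y × xs <L ys)

-- Polynomials in K[y₁,…,yₙ], represented by their coefficient functions
-- on exponent vectors (monomials).

module Poly {c ℓ} (K : Field c ℓ) (n : ℕ) where
  open Field K

  Mon : Set
  Mon = Vec ℕ n

  Pol : Set c
  Pol = Mon → Carrier

  _≈P_ : Pol → Pol → Set ℓ
  p ≈P q = ∀ m → p m ≈ q m

  IsZero : Pol → Set ℓ
  IsZero p = ∀ m → p m ≈ 0#

  0P : Pol
  0P _ = 0#

  _+P_ : Pol → Pol → Pol
  (p +P q) m = p m + q m

  _-P_ : Pol → Pol → Pol
  (p -P q) m = p m - q m

  _·P_ : Carrier → Pol → Pol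
  (k ·P p) m = k * p m

  sumP : List Pol → Pol
  sumP = foldr _+P_ 0P

  mono : Mon → Pol
  mono a m = if does (≡-dec ℕP._≟_ m a) then 1# else 0#

  term : Carrier → Mon → Pol
  term k a = k ·P mono a

  _∣M_ : Mon → Mon → Set
  a ∣M b = Pointwise _≤_ a b

  -- y^a · p
  shift : Mon → Pol → Pol
  shift a p m = if does (PW.decidable _≤?_ a m) then p (zipWith _∸_ m a) else 0#

  LM : Pol → Mon → Set ℓ
  LM p m = ¬ (p m ≈ 0#) × (∀ m' → m <L m' → p m' ≈ 0#)

  -- exponent vector of a square-free monomial given by a bitstring
  toExp : Vec Bool n → Mon
  toExp = Vec.map (λ b → if b then 1 else 0)

  ℓ₁ : Vec Bool n → ℕ
  ℓ₁ α = ones (toList α)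

  IsMCP : Vec Bool n → Set
  IsMCP α = ∃[ w ] ∃[ m ] (toList α ≡ w ++ true ∷ replicateL m false
                           × zeros w ≡ ones w × StaysAbove w)

  P : Vec Bool n → Vec Bool n → Set
  P α β = β ≢ α × ones (toList β) ≡ ones (toList α)
          × (∀ (i : Fin n) → suc (toℕ i) ≤ 2 *ℕ ℓ₁ α ∸ 1 → lookup α i ≡ false → lookup β i ≡ false)

  P? : ∀ α β → Dec (P α β)
  P? α β = ¬? (≡-dec BoolP._≟_ β α) ×-dec (ℕP._≟_ _ _)
           ×-dec all? (λ i → (_ ≤? _) →-dec ((lookup α i BoolP.≟ false) →-dec (lookup β i BoolP.≟ false)))

  g : Vec Bool n → Pol
  g α = mono (toExp α) +P sumP (List.map (λ β → mono (toExp β)) (filter (P? α) (allBits n)))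

  e : Fin n → Mon
  e i = Vec.replicate n 0 [ i ]≔ 1

  ysq : Fin n → Pol
  ysq i = mono (Vec.replicate n 0 [ i ]≔ 2)

  -- the set F_ℓ (index i : Fin n is y_{i+1}, so y₂..yₙ are 1 ≤ toℕ i)
  data InF (l : ℕ) : Pol → Set c where
    sq  : (i : Fin n) → 1 ≤ toℕ i → InF l (ysq i)
    mcp : (α : Vec Bool n) → IsMCP α → ℓ₁ α ≤ suc l → InF l (g α)

  -- one step of the multivariate division algorithm on a state (p , r)
  -- (p = what is still to be divided, r = remainder accumulated so far)
  data Step (S : Pol → Set c) : Pol × Pol → Pol × Pol → Set (c ⊔ ℓ) where
    divide : ∀ {p r f m m' k} → S f → LM p m → LM f m' → m' ∣M m →
             f m' * k ≈ p m →
             Step S (p , r) (p -P (k ·P shift (zipWith _∸_ m m') f) , r)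
    toRem  : ∀ {p r m} → LM p m →
             (∀ f m' → S f → LM f m' → ¬ (m' ∣M m)) →
             Step S (p , r) (p -P term (p m) m , r +P term (p m) m)

  IsRemainder : (Pol → Set c) → Pol → Pol → Set (c ⊔ ℓ)
  IsRemainder S p r = ∃[ p' ] (Star (Step S) (p , 0P) (p' , r) × IsZero p')

  BElt : Set
  BElt = Σ (Vec Bool n) (λ γ → StaysAbove (toList γ))

  InSpanB : Pol → Set (c ⊔ ℓ)
  InSpanB r = ∃[ cs ] (r ≈P sumP (List.map (λ (x : Carrier × BElt) →
                        term (Data.Product.proj₁ x) (toExp (Data.Product.proj₁ (Data.Product.proj₂ x)))) cs))

  -- elements of R = K[y₁..yₙ]: finite K-combinations of monomials
  IsPoly : Pol → Set (c ⊔ ℓ)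
  IsPoly p = ∃[ ts ] (p ≈P sumP (List.map (λ (x : Carrier × Mon) →
                        term (Data.Product.proj₁ x) (Data.Product.proj₂ x)) ts))

  data GenI : Pol → Set c where
    lin : GenI (sumP (List.map (λ i → mono (e i)) (allFin n)))
    sq  : (i : Fin n) → GenI (ysq i)

  data Comb (S : Pol → Set c) : Pol → Set c where
    nil  : Comb S 0P
    cons : ∀ {h q} → S h → (k : Carrier) (a : Mon) → Comb S q →
           Comb S ((k ·P shift a h) +P q)

  InIdeal : (Pol → Set c) → Pol → Set (c ⊔ ℓ)
  InIdeal S p = ∃[ q ] (Comb S q × p ≈P q)

-- Remainders: the division algorithm only moves into the remainder monomials divisible by no leading
-- monomial of F_ℓ. The leading monomial of g_α is y^α, since every β ∈ P_α is lex-smaller than α. So such a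
-- monomial contains neither y₁ (= LM g_{10…0}) nor a square, and its bitstring has no first descent, i.e. no
-- shortest prefix w1 with more ones than zeros: otherwise the MCP w 1 0…0, with ℓ₁ ≤ ⌊(n−1)/2⌋ + 1, would
-- divide it. Hence it lies in B.
--
-- Spanning: modulo the squares, R/I is A = K[y]/(y₁²,…,yₙ²) modulo L = y₁ + ⋯ + yₙ. In A we have
-- L e_d = (d + 1) e_{d+1}, so in characteristic 0 each e_{d+1} lies in (L), and removing a variable keeps this
-- (e_{d+1}(V) = e_{d+1}(V ∪ {y_i}) − y_i e_d(V ∪ {y_i})) as long as at most d variables are missing. If T ∉ B has
-- first descent w1 and j = |w| + 1, then y^{T_{>j}} e_{ones w + 1}(prefix variables of T and all later ones)
-- lies in (L) and has lex-leading term y^T with coefficient 1, so y^T reduces to lex-smaller monomials.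

module Submission where

open import Defs
open import Level using (Level; _⊔_)
open import Function using (id; _∘_)
open import Data.Bool as Bool using (Bool; true; false; if_then_else_)
import Data.Bool.Properties as BoolP
open import Data.Empty using (⊥; ⊥-elim)
open import Data.Fin as Fin using (Fin)
open import Data.List as List using (List; []; _∷_; _++_)
import Data.List.Properties as ListP
open import Data.Nat as ℕ using (ℕ; zero; suc; z≤n; s≤s; _≤_; _∸_; _/_) renaming (_+_ to _+ℕ_)
import Data.Nat.Properties as ℕP
open import Data.Product using (Σ; ∃-syntax; _×_; _,_; proj₁; proj₂)
open import Data.Sum using (_⊎_; inj₁; inj₂)
open import Data.Unit using (⊤; tt)
open import Data.Vec as Vec using (Vec; []; _∷_)
open import Data.Vec.Properties as VecP using (≡-dec)
import Data.Vec.Relation.Binary.Pointwise.Inductive as PW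
open import Data.Vec.Relation.Binary.Lex.Strict as Lex using (Lex-<; this; next)
open import Induction.WellFounded using (WellFounded)
open import Relation.Binary.PropositionalEquality as ≡ using (_≡_; _≢_; refl)
open import Relation.Nullary using (¬_; Dec; does; yes; no)
open import Relation.Nullary.Decidable using (dec-true; dec-false)

module Bitstrings where

  _≺_ : ∀ {k} → Vec Bool k → Vec Bool k → Set
  _≺_ {k} = Lex-< _≡_ Bool._<_ {k} {k}

  ≺-wellFounded : ∀ {k} → WellFounded (_≺_ {k})
  ≺-wellFounded = Lex.<-wellFounded ≡.trans (λ { refl x<y → x<y }) BoolP.<-wellFounded

  StaysAboveFrom : ℕ → List Bool → Set
  StaysAboveFrom d [] = ⊤
  StaysAboveFrom d (false ∷ xs) = StaysAboveFrom (suc d) xs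
  StaysAboveFrom zero (true ∷ xs) = ⊥
  StaysAboveFrom (suc d) (true ∷ xs) = StaysAboveFrom d xs

  staysAboveFrom⇒ : ∀ d xs → StaysAboveFrom d xs → ∀ k → ones (List.take k xs) ≤ d +ℕ zeros (List.take k xs)
  staysAboveFrom⇒ d [] _ zero = z≤n
  staysAboveFrom⇒ d [] _ (suc k) = z≤n
  staysAboveFrom⇒ d (x ∷ xs) _ zero = z≤n
  staysAboveFrom⇒ d (false ∷ xs) s (suc k) =
    ℕP.≤-trans (staysAboveFrom⇒ (suc d) xs s k) (ℕP.≤-reflexive (≡.sym (ℕP.+-suc d _)))
  staysAboveFrom⇒ (suc d) (true ∷ xs) s (suc k) = s≤s (staysAboveFrom⇒ d xs s k)

  staysAboveFrom0⇒staysAbove : ∀ xs → StaysAboveFrom 0 xs → StaysAbove xs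
  staysAboveFrom0⇒staysAbove = staysAboveFrom⇒ 0

  FirstDescent : ℕ → List Bool → Set
  FirstDescent d xs = ∃[ w ] ∃[ v ] (xs ≡ w ++ true ∷ v) × (zeros w +ℕ d ≡ ones w) × StaysAboveFrom d w

  staysAboveFrom? : ∀ d xs → StaysAboveFrom d xs ⊎ FirstDescent d xs
  staysAboveFrom? d [] = inj₁ tt
  staysAboveFrom? d (false ∷ xs) with staysAboveFrom? (suc d) xs
  ... | inj₁ s = inj₁ s
  ... | inj₂ (w , v , eq , bal , s) =
    inj₂ (false ∷ w , v , ≡.cong (false ∷_) eq , ≡.trans (≡.sym (ℕP.+-suc (zeros w) d)) bal , s)
  staysAboveFrom? zero (true ∷ xs) = inj₂ ([] , xs , refl , refl , tt)
  staysAboveFrom? (suc d) (true ∷ xs) with staysAboveFrom? d xs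
  ... | inj₁ s = inj₁ s
  ... | inj₂ (w , v , eq , bal , s) =
    inj₂ (true ∷ w , v , ≡.cong (true ∷_) eq , ≡.trans (ℕP.+-suc (zeros w) d) (≡.cong suc bal) , s)

  ones-++ : ∀ xs ys → ones (xs ++ ys) ≡ ones xs +ℕ ones ys
  ones-++ [] ys = refl
  ones-++ (false ∷ xs) ys = ones-++ xs ys
  ones-++ (true ∷ xs) ys = ≡.cong suc (ones-++ xs ys)

  ones-replicate-false : ∀ m → ones (replicateL m false) ≡ 0
  ones-replicate-false zero = refl
  ones-replicate-false (suc m) = ones-replicate-false m

  ones-[w1]++replicate-false : ∀ w m → ones (w ++ true ∷ replicateL m false) ≡ suc (ones w)
  ones-[w1]++replicate-false w m = begin
    ones (w ++ true ∷ replicateL m false)  ≡⟨ ones-++ w _ ⟩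
    ones w +ℕ suc (ones (replicateL m false)) ≡⟨ ≡.cong (λ z → ones w +ℕ suc z) (ones-replicate-false m) ⟩
    ones w +ℕ 1                              ≡⟨ ℕP.+-comm (ones w) 1 ⟩
    suc (ones w)                             ∎
    where open ≡.≡-Reasoning

  length≡zeros+ones : ∀ xs → List.length xs ≡ zeros xs +ℕ ones xs
  length≡zeros+ones [] = refl
  length≡zeros+ones (false ∷ xs) = ≡.cong suc (length≡zeros+ones xs)
  length≡zeros+ones (true ∷ xs) =
    ≡.trans (≡.cong suc (length≡zeros+ones xs)) (≡.sym (ℕP.+-suc (zeros xs) (ones xs)))

  length-balanced : ∀ xs → zeros xs ≡ ones xs → List.length xs ≡ 2 ℕ.* ones xs
  length-balanced xs balanced = ≡.trans (length≡zeros+ones xs)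
    (≡.trans (≡.cong (_+ℕ ones xs) balanced) (≡.cong (ones xs +ℕ_) (≡.sym (ℕP.+-identityʳ (ones xs)))))

  toList-replicate-false : ∀ k → Vec.toList (Vec.replicate k false) ≡ replicateL k false
  toList-replicate-false zero = refl
  toList-replicate-false (suc k) = ≡.cong (false ∷_) (toList-replicate-false k)

  ones≡0⇒replicate-false : ∀ {k} (v : Vec Bool k) → ones (Vec.toList v) ≡ 0 → v ≡ Vec.replicate k false
  ones≡0⇒replicate-false [] _ = refl
  ones≡0⇒replicate-false (false ∷ v) e = ≡.cong (false ∷_) (ones≡0⇒replicate-false v e)

  zeros-replicate-true : ∀ k → zeros (Vec.toList (Vec.replicate k true)) ≡ 0
  zeros-replicate-true zero = refl
  zeros-replicate-true (suc k) = zeros-replicate-true k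

  clearPrefix : ∀ {k} → ℕ → Vec Bool k → Vec Bool k
  clearPrefix zero T = T
  clearPrefix (suc j) [] = []
  clearPrefix (suc j) (t ∷ T) = false ∷ clearPrefix j T

  keepPrefix : ∀ {k} → ℕ → Vec Bool k → Vec Bool k
  keepPrefix {k} zero T = Vec.replicate k false
  keepPrefix (suc j) [] = []
  keepPrefix (suc j) (t ∷ T) = t ∷ keepPrefix j T

  fillSuffix : ∀ {k} → ℕ → Vec Bool k → Vec Bool k
  fillSuffix {k} zero T = Vec.replicate k true
  fillSuffix (suc j) [] = []
  fillSuffix (suc j) (t ∷ T) = t ∷ fillSuffix j T

  onesInPrefix : ∀ {k} → ℕ → Vec Bool k → ℕ
  onesInPrefix j T = ones (List.take j (Vec.toList T))

  toList-keepPrefix : ∀ {k} w v (T : Vec Bool k) → Vec.toList T ≡ w ++ true ∷ v →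
    Vec.toList (keepPrefix (suc (List.length w)) T) ≡ w ++ true ∷ replicateL (List.length v) false
  toList-keepPrefix [] v (t ∷ T) eq with ListP.∷-injective eq
  ... | refl , eq′ = ≡.cong (true ∷_) (≡.trans (toList-replicate-false _)
        (≡.cong (λ z → replicateL z false) (≡.trans (≡.sym (VecP.length-toList T)) (≡.cong List.length eq′))))
  toList-keepPrefix (x ∷ w) v (t ∷ T) eq with ListP.∷-injective eq
  ... | refl , eq′ = ≡.cong (t ∷_) (toList-keepPrefix w v T eq′)

  onesInPrefix-descent : ∀ {k} w v (T : Vec Bool k) → Vec.toList T ≡ w ++ true ∷ v →
    onesInPrefix (suc (List.length w)) T ≡ suc (ones w)
  onesInPrefix-descent [] v (t ∷ T) eq with ListP.∷-injective eq
  ... | refl , _ = refl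
  onesInPrefix-descent (x ∷ w) v (t ∷ T) eq with ListP.∷-injective eq
  onesInPrefix-descent (false ∷ w) v (false ∷ T) eq | refl , eq′ = onesInPrefix-descent w v T eq′
  onesInPrefix-descent (true ∷ w) v (true ∷ T) eq | refl , eq′ = ≡.cong suc (onesInPrefix-descent w v T eq′)

  zeros-fillSuffix-descent : ∀ {k} w v (T : Vec Bool k) → Vec.toList T ≡ w ++ true ∷ v →
    zeros (Vec.toList (fillSuffix (suc (List.length w)) T)) ≡ zeros w
  zeros-fillSuffix-descent [] v (t ∷ T) eq with ListP.∷-injective eq
  ... | refl , _ = zeros-replicate-true (Vec.length T)
  zeros-fillSuffix-descent (x ∷ w) v (t ∷ T) eq with ListP.∷-injective eq
  zeros-fillSuffix-descent (false ∷ w) v (false ∷ T) eq | refl , eq′ = ≡.cong suc (zeros-fillSuffix-descent w v T eq′)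
  zeros-fillSuffix-descent (true ∷ w) v (true ∷ T) eq | refl , eq′ = zeros-fillSuffix-descent w v T eq′

module FiniteSums {c ℓ} (K : Field c ℓ) where
  open Field K hiding (zero) renaming (refl to ≈-refl; sym to ≈-sym; trans to ≈-trans)
  open import Relation.Binary.Reasoning.Setoid setoid

  ∑ : ∀ {a} {A : Set a} → List A → (A → Carrier) → Carrier
  ∑ [] f = 0#
  ∑ (x ∷ xs) f = f x + ∑ xs f

  syntax ∑ xs (λ x → e) = ∑[ x ∈ xs ] e

  module _ {a} {A : Set a} where

    ∑-cong : ∀ (xs : List A) {f g : A → Carrier} → (∀ x → f x ≈ g x) → ∑ xs f ≈ ∑ xs g
    ∑-cong [] _ = ≈-refl
    ∑-cong (x ∷ xs) f≈g = +-cong (f≈g x) (∑-cong xs f≈g)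

    ∑-zero : ∀ (xs : List A) {f : A → Carrier} → (∀ x → f x ≈ 0#) → ∑ xs f ≈ 0#
    ∑-zero [] _ = ≈-refl
    ∑-zero (x ∷ xs) f≈0 = ≈-trans (+-cong (f≈0 x) (∑-zero xs f≈0)) (+-identityʳ 0#)

    ∑-*ˡ : ∀ (xs : List A) k f → ∑[ x ∈ xs ] (k * f x) ≈ k * ∑ xs f
    ∑-*ˡ [] k f = ≈-sym (zeroʳ k)
    ∑-*ˡ (x ∷ xs) k f = ≈-trans (+-cong ≈-refl (∑-*ˡ xs k f)) (≈-sym (distribˡ k _ _))

    ∑-++ : ∀ (xs ys : List A) f → ∑ (xs ++ ys) f ≈ ∑ xs f + ∑ ys f
    ∑-++ [] ys f = ≈-sym (+-identityˡ _)
    ∑-++ (x ∷ xs) ys f = ≈-trans (+-cong ≈-refl (∑-++ xs ys f)) (≈-sym (+-assoc _ _ _))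

    ∑-map : ∀ {b} {B : Set b} (h : A → B) (xs : List A) f → ∑ (List.map h xs) f ≡ ∑[ x ∈ xs ] f (h x)
    ∑-map h [] f = refl
    ∑-map h (x ∷ xs) f = ≡.cong (f (h x) +_) (∑-map h xs f)

    ∑-filter-zero : ∀ {q} {Q : A → Set q} (Q? : ∀ x → Dec (Q x)) (f : A → Carrier) xs →
                    (∀ x → Q x → f x ≈ 0#) → ∑ (List.filter Q? xs) f ≈ 0#
    ∑-filter-zero Q? f [] _ = ≈-refl
    ∑-filter-zero Q? f (x ∷ xs) f≈0 with Q? x
    ... | yes Qx = ≈-trans (+-cong (f≈0 x Qx) (∑-filter-zero Q? f xs f≈0)) (+-identityʳ 0#)
    ... | no _ = ∑-filter-zero Q? f xs f≈0

  ∑-allBits-suc : ∀ k f → ∑ (allBits (suc k)) f ≈ ∑[ T ∈ allBits k ] f (false ∷ T) + ∑[ T ∈ allBits k ] f (true ∷ T)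
  ∑-allBits-suc k f = begin
    ∑ (List.map (false ∷_) (allBits k) ++ List.map (true ∷_) (allBits k)) f
      ≈⟨ ∑-++ (List.map (false ∷_) (allBits k)) _ f ⟩
    ∑ (List.map (false ∷_) (allBits k)) f + ∑ (List.map (true ∷_) (allBits k)) f
      ≡⟨ ≡.cong₂ _+_ (∑-map _ (allBits k) f) (∑-map _ (allBits k) f) ⟩
    ∑[ T ∈ allBits k ] f (false ∷ T) + ∑[ T ∈ allBits k ] f (true ∷ T) ∎

module SquareFreeQuotient {c ℓ} (K : Field c ℓ) where
  open Field K hiding (zero) renaming (refl to ≈-refl; sym to ≈-sym; trans to ≈-trans; reflexive to ≈-reflexive)
  open import Algebra.Properties.Ring ring using (-1*x≈-x; -0#≈0#)
  open import Algebra.Properties.CommutativeSemigroup +-commutativeSemigroup using (interchange)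
  open import Relation.Binary.Reasoning.Setoid setoid
  open FiniteSums K

  -- K[y₁,…,y_k]/(y₁²,…,y_k²), an element f standing for Σ_T f T · y^T
  SqFree : ℕ → Set c
  SqFree k = Vec Bool k → Carrier

  𝟙 : Bool → Carrier
  𝟙 b = if b then 1# else 0#

  sameBits : ∀ {k} → Vec Bool k → Vec Bool k → Bool
  sameBits S T = does (≡-dec BoolP._≟_ S T)

  basis : ∀ {k} → Vec Bool k → SqFree k
  basis S T = 𝟙 (sameBits S T)

  basis-self : ∀ {k} (S : Vec Bool k) → basis S S ≡ 1#
  basis-self S = ≡.cong 𝟙 (dec-true (≡-dec BoolP._≟_ S S) refl)

  basis-≢ : ∀ {k} {S T : Vec Bool k} → S ≢ T → basis S T ≡ 0#
  basis-≢ {S = S} {T} S≢T = ≡.cong 𝟙 (dec-false (≡-dec BoolP._≟_ S T) S≢T)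

  ∑-basis : ∀ {k} (f : SqFree k) T → ∑[ S ∈ allBits k ] (f S * basis S T) ≈ f T
  ∑-basis {zero} f [] = ≈-trans (+-identityʳ _) (*-identityʳ (f []))
  ∑-basis {suc k} f (false ∷ T) = begin
    _ ≈⟨ ∑-allBits-suc k _ ⟩
    ∑[ S ∈ allBits k ] (f (false ∷ S) * basis S T) + ∑[ S ∈ allBits k ] (f (true ∷ S) * 0#)
      ≈⟨ +-cong (∑-basis (λ S → f (false ∷ S)) T) (∑-zero (allBits k) (λ S → zeroʳ _)) ⟩
    f (false ∷ T) + 0# ≈⟨ +-identityʳ _ ⟩
    f (false ∷ T) ∎
  ∑-basis {suc k} f (true ∷ T) = begin
    _ ≈⟨ ∑-allBits-suc k _ ⟩
    ∑[ S ∈ allBits k ] (f (false ∷ S) * 0#) + ∑[ S ∈ allBits k ] (f (true ∷ S) * basis S T)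
      ≈⟨ +-cong (∑-zero (allBits k) (λ S → zeroʳ _)) (∑-basis (λ S → f (true ∷ S)) T) ⟩
    0# + f (true ∷ T) ≈⟨ +-identityˡ _ ⟩
    f (true ∷ T) ∎

  -- multiplication by y₁ + ⋯ + y_k
  mulLinear : ∀ {k} → SqFree k → SqFree k
  mulLinear f [] = 0#
  mulLinear f (b ∷ T) = (if b then f (false ∷ T) else 0#) + mulLinear (λ U → f (b ∷ U)) T

  mulLinear-cong : ∀ {k} {f g : SqFree k} → (∀ T → f T ≈ g T) → ∀ T → mulLinear f T ≈ mulLinear g T
  mulLinear-cong f≈g [] = ≈-refl
  mulLinear-cong f≈g (false ∷ T) = +-cong ≈-refl (mulLinear-cong (λ U → f≈g (false ∷ U)) T)
  mulLinear-cong f≈g (true ∷ T) = +-cong (f≈g (false ∷ T)) (mulLinear-cong (λ U → f≈g (true ∷ U)) T)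

  mulLinear-zero : ∀ {k} {f : SqFree k} → (∀ T → f T ≈ 0#) → ∀ T → mulLinear f T ≈ 0#
  mulLinear-zero f≈0 [] = ≈-refl
  mulLinear-zero f≈0 (false ∷ T) = ≈-trans (+-identityˡ _) (mulLinear-zero (λ U → f≈0 (false ∷ U)) T)
  mulLinear-zero f≈0 (true ∷ T) =
    ≈-trans (+-cong (f≈0 _) (mulLinear-zero (λ U → f≈0 (true ∷ U)) T)) (+-identityʳ 0#)

  mulLinear-+ : ∀ {k} (f g : SqFree k) T → mulLinear (λ U → f U + g U) T ≈ mulLinear f T + mulLinear g T
  mulLinear-+ f g [] = ≈-sym (+-identityʳ 0#)
  mulLinear-+ f g (false ∷ T) = begin
    0# + mulLinear (λ U → f (false ∷ U) + g (false ∷ U)) T ≈⟨ +-identityˡ _ ⟩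
    mulLinear (λ U → f (false ∷ U) + g (false ∷ U)) T      ≈⟨ mulLinear-+ _ _ T ⟩
    mulLinear (λ U → f (false ∷ U)) T + mulLinear (λ U → g (false ∷ U)) T
      ≈⟨ ≈-sym (+-cong (+-identityˡ _) (+-identityˡ _)) ⟩
    (0# + mulLinear (λ U → f (false ∷ U)) T) + (0# + mulLinear (λ U → g (false ∷ U)) T) ∎
  mulLinear-+ f g (true ∷ T) = ≈-trans (+-cong ≈-refl (mulLinear-+ _ _ T)) (interchange _ _ _ _)

  mulLinear-*ˡ : ∀ {k} a (f : SqFree k) T → mulLinear (λ U → a * f U) T ≈ a * mulLinear f T
  mulLinear-*ˡ a f [] = ≈-sym (zeroʳ a)
  mulLinear-*ˡ a f (false ∷ T) =
    ≈-trans (+-identityˡ _) (≈-trans (mulLinear-*ˡ a _ T) (*-cong ≈-refl (≈-sym (+-identityˡ _))))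
  mulLinear-*ˡ a f (true ∷ T) = ≈-trans (+-cong ≈-refl (mulLinear-*ˡ a _ T)) (≈-sym (distribˡ a _ _))

  mulLinear-∑ : ∀ {a} {A : Set a} {k} (xs : List A) (F : A → SqFree k) T →
                mulLinear (λ U → ∑[ x ∈ xs ] F x U) T ≈ ∑[ x ∈ xs ] mulLinear (F x) T
  mulLinear-∑ [] F T = mulLinear-zero (λ _ → ≈-refl) T
  mulLinear-∑ (x ∷ xs) F T = ≈-trans (mulLinear-+ (F x) _ T) (+-cong ≈-refl (mulLinear-∑ xs F T))

  mulMonomial : ∀ {k} → Vec Bool k → SqFree k → SqFree k
  mulMonomial [] f [] = f []
  mulMonomial (false ∷ S) f (t ∷ T) = mulMonomial S (λ U → f (t ∷ U)) T
  mulMonomial (true ∷ S) f (true ∷ T) = mulMonomial S (λ U → f (false ∷ U)) T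
  mulMonomial (true ∷ S) f (false ∷ T) = 0#

  mulMonomial-cong : ∀ {k} (S : Vec Bool k) {f g : SqFree k} → (∀ T → f T ≈ g T) → ∀ T →
                     mulMonomial S f T ≈ mulMonomial S g T
  mulMonomial-cong [] f≈g [] = f≈g []
  mulMonomial-cong (false ∷ S) f≈g (t ∷ T) = mulMonomial-cong S (λ U → f≈g (t ∷ U)) T
  mulMonomial-cong (true ∷ S) f≈g (true ∷ T) = mulMonomial-cong S (λ U → f≈g (false ∷ U)) T
  mulMonomial-cong (true ∷ S) f≈g (false ∷ T) = ≈-refl

  mulMonomial-zero : ∀ {k} (S : Vec Bool k) {f : SqFree k} → (∀ T → f T ≈ 0#) → ∀ T → mulMonomial S f T ≈ 0#
  mulMonomial-zero [] f≈0 [] = f≈0 []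
  mulMonomial-zero (false ∷ S) f≈0 (t ∷ T) = mulMonomial-zero S (λ U → f≈0 (t ∷ U)) T
  mulMonomial-zero (true ∷ S) f≈0 (true ∷ T) = mulMonomial-zero S (λ U → f≈0 (false ∷ U)) T
  mulMonomial-zero (true ∷ S) f≈0 (false ∷ T) = ≈-refl

  mulMonomial-+ : ∀ {k} (S : Vec Bool k) (f g : SqFree k) T →
                  mulMonomial S (λ U → f U + g U) T ≈ mulMonomial S f T + mulMonomial S g T
  mulMonomial-+ [] f g [] = ≈-refl
  mulMonomial-+ (false ∷ S) f g (t ∷ T) = mulMonomial-+ S _ _ T
  mulMonomial-+ (true ∷ S) f g (true ∷ T) = mulMonomial-+ S _ _ T
  mulMonomial-+ (true ∷ S) f g (false ∷ T) = ≈-sym (+-identityʳ 0#)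

  mulMonomial-one : ∀ {k} (f : SqFree k) T → mulMonomial (Vec.replicate k false) f T ≡ f T
  mulMonomial-one f [] = refl
  mulMonomial-one f (t ∷ T) = mulMonomial-one (λ U → f (t ∷ U)) T

  mulMonomial-mulLinear : ∀ {k} (S : Vec Bool k) (g : SqFree k) T →
                          mulMonomial S (mulLinear g) T ≈ mulLinear (mulMonomial S g) T
  mulMonomial-mulLinear [] g [] = ≈-refl
  mulMonomial-mulLinear (false ∷ S) g (false ∷ T) = begin
    mulMonomial S (λ U → 0# + mulLinear (λ V → g (false ∷ V)) U) T
      ≈⟨ mulMonomial-cong S (λ U → +-identityˡ _) T ⟩
    mulMonomial S (mulLinear (λ V → g (false ∷ V))) T ≈⟨ mulMonomial-mulLinear S _ T ⟩
    mulLinear (mulMonomial S (λ V → g (false ∷ V))) T ≈⟨ +-identityˡ _ ⟨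
    0# + mulLinear (mulMonomial S (λ V → g (false ∷ V))) T ∎
  mulMonomial-mulLinear (false ∷ S) g (true ∷ T) =
    ≈-trans (mulMonomial-+ S _ _ T) (+-cong ≈-refl (mulMonomial-mulLinear S _ T))
  mulMonomial-mulLinear (true ∷ S) g (true ∷ T) = begin
    mulMonomial S (λ U → 0# + mulLinear (λ V → g (false ∷ V)) U) T
      ≈⟨ mulMonomial-cong S (λ U → +-identityˡ _) T ⟩
    mulMonomial S (mulLinear (λ V → g (false ∷ V))) T ≈⟨ mulMonomial-mulLinear S _ T ⟩
    mulLinear (mulMonomial S (λ V → g (false ∷ V))) T ≈⟨ +-identityˡ _ ⟨
    0# + mulLinear (mulMonomial S (λ V → g (false ∷ V))) T ∎
  mulMonomial-mulLinear (true ∷ S) g (false ∷ T) =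
    ≈-sym (≈-trans (+-identityˡ _) (mulLinear-zero (λ _ → ≈-refl) T))

  LinearMultiple : ∀ {k} → SqFree k → Set (c ⊔ ℓ)
  LinearMultiple {k} f = ∃[ g ] ∀ T → f T ≈ mulLinear g T

  linearMultiple-resp : ∀ {k} {f f′ : SqFree k} → (∀ T → f T ≈ f′ T) → LinearMultiple f′ → LinearMultiple f
  linearMultiple-resp f≈f′ (g , f′≈Lg) = g , λ T → ≈-trans (f≈f′ T) (f′≈Lg T)

  linearMultiple-sub : ∀ {k} {f h : SqFree k} → LinearMultiple f → LinearMultiple h → LinearMultiple (λ T → f T - h T)
  linearMultiple-sub (g₁ , p₁) (g₂ , p₂) = (λ T → g₁ T + (- 1#) * g₂ T) , λ T → begin
    _ - _                                      ≈⟨ +-cong (p₁ T) (-‿cong (p₂ T)) ⟩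
    mulLinear g₁ T - mulLinear g₂ T            ≈⟨ +-cong ≈-refl (-1*x≈-x _) ⟨
    mulLinear g₁ T + (- 1#) * mulLinear g₂ T   ≈⟨ +-cong ≈-refl (mulLinear-*ˡ (- 1#) g₂ T) ⟨
    mulLinear g₁ T + mulLinear (λ U → (- 1#) * g₂ U) T ≈⟨ mulLinear-+ g₁ _ T ⟨
    mulLinear (λ U → g₁ U + (- 1#) * g₂ U) T  ∎

  linearMultiple-mulMonomial : ∀ {k} (S : Vec Bool k) {f : SqFree k} → LinearMultiple f →
                               LinearMultiple (mulMonomial S f)
  linearMultiple-mulMonomial S (g , f≈Lg) =
    mulMonomial S g , λ T → ≈-trans (mulMonomial-cong S f≈Lg T) (mulMonomial-mulLinear S g T)

  -- the elementary symmetric polynomial of degree d in the variables y_i with V_i = 1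
  elementary : ∀ {k} → Vec Bool k → ℕ → SqFree k
  elementary [] zero [] = 1#
  elementary [] (suc d) [] = 0#
  elementary (v ∷ V) d (false ∷ T) = elementary V d T
  elementary (v ∷ V) zero (true ∷ T) = 0#
  elementary (false ∷ V) (suc d) (true ∷ T) = 0#
  elementary (true ∷ V) (suc d) (true ∷ T) = elementary V d T

  elementary-outside : ∀ {k} (V : Vec Bool k) d T → elementary (false ∷ V) d (true ∷ T) ≈ 0#
  elementary-outside V zero T = ≈-refl
  elementary-outside V (suc d) T = ≈-refl

  elementary-zero-indep : ∀ {k} (V W : Vec Bool k) T → elementary V 0 T ≡ elementary W 0 T
  elementary-zero-indep [] [] [] = refl
  elementary-zero-indep (v ∷ V) (w ∷ W) (false ∷ T) = elementary-zero-indep V W T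
  elementary-zero-indep (v ∷ V) (w ∷ W) (true ∷ T) = refl

  allVariables : ∀ k → Vec Bool k
  allVariables k = Vec.replicate k true

  -- each square-free monomial of degree d + 1 is y_i times a monomial of e_d in exactly d + 1 ways
  mulLinear-elementary : ∀ {k} d T →
    mulLinear (elementary (allVariables k) d) T ≈ natK K (suc d) * elementary (allVariables k) (suc d) T
  mulLinear-elementary d [] = ≈-sym (zeroʳ _)
  mulLinear-elementary d (false ∷ T) = ≈-trans (+-identityˡ _) (mulLinear-elementary d T)
  mulLinear-elementary zero (true ∷ T) = begin
    e + mulLinear (λ _ → 0#) T ≈⟨ +-cong ≈-refl (mulLinear-zero (λ _ → ≈-refl) T) ⟩
    e + 0#                      ≈⟨ +-identityʳ e ⟩
    e                           ≈⟨ *-identityˡ e ⟨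
    1# * e                      ≈⟨ *-cong (+-identityʳ 1#) ≈-refl ⟨
    (1# + 0#) * e               ∎
    where e = elementary (allVariables _) zero T
  mulLinear-elementary (suc d) (true ∷ T) = begin
    e + mulLinear (elementary (allVariables _) d) T ≈⟨ +-cong ≈-refl (mulLinear-elementary d T) ⟩
    e + natK K (suc d) * e                         ≈⟨ +-cong (*-identityˡ e) ≈-refl ⟨
    1# * e + natK K (suc d) * e                    ≈⟨ distribʳ e 1# _ ⟨
    (1# + natK K (suc d)) * e                      ∎
    where e = elementary (allVariables _) (suc d) T

  singleton : ∀ {k} → Fin k → Vec Bool k
  singleton {k} i = Vec.replicate k false Vec.[ i ]≔ true

  -- the monomials of e_{d+1}(V ∪ {y_i}) that contain y_i are exactly y_i times those of e_d(V ∪ {y_i})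
  elementary-insert : ∀ {k} (i : Fin k) (V : Vec Bool k) → Vec.lookup V i ≡ false → ∀ d T →
    elementary V (suc d) T ≈ elementary (V Vec.[ i ]≔ true) (suc d) T
                             - mulMonomial (singleton i) (elementary (V Vec.[ i ]≔ true) d) T
  elementary-insert Fin.zero (false ∷ V) refl d (false ∷ T) = ≈-sym (≈-trans (+-cong ≈-refl -0#≈0#) (+-identityʳ _))
  elementary-insert Fin.zero (false ∷ V) refl d (true ∷ T) =
    ≈-sym (≈-trans (+-cong ≈-refl (-‿cong (≈-reflexive (mulMonomial-one _ T)))) (-‿inverseʳ _))
  elementary-insert (Fin.suc i) (v ∷ V) Vi≡0 d (false ∷ T) = elementary-insert i V Vi≡0 d T
  elementary-insert (Fin.suc i) (false ∷ V) Vi≡0 d (true ∷ T) = ≈-sym (begin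
    0# - mulMonomial (singleton i) (λ U → elementary (false ∷ _) d (true ∷ U)) T
      ≈⟨ +-cong ≈-refl (-‿cong (mulMonomial-zero (singleton i) (elementary-outside _ d) T)) ⟩
    0# - 0# ≈⟨ -‿inverseʳ 0# ⟩
    0#      ∎)
  elementary-insert (Fin.suc i) (true ∷ V) Vi≡0 zero (true ∷ T) = ≈-sym (begin
    elementary (V Vec.[ i ]≔ true) 0 T - mulMonomial (singleton i) (λ _ → 0#) T
      ≈⟨ +-cong (≈-reflexive (elementary-zero-indep (V Vec.[ i ]≔ true) V T))
                (-‿cong (mulMonomial-zero (singleton i) (λ _ → ≈-refl) T)) ⟩
    elementary V 0 T - 0# ≈⟨ +-cong ≈-refl -0#≈0# ⟩
    elementary V 0 T + 0# ≈⟨ +-identityʳ _ ⟩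
    elementary V 0 T      ∎)
  elementary-insert (Fin.suc i) (true ∷ V) Vi≡0 (suc d) (true ∷ T) = elementary-insert i V Vi≡0 d T

  zeros≡0⇒allVariables : ∀ {k} (V : Vec Bool k) → zeros (Vec.toList V) ≡ 0 → V ≡ allVariables k
  zeros≡0⇒allVariables [] _ = refl
  zeros≡0⇒allVariables (true ∷ V) e = ≡.cong (true ∷_) (zeros≡0⇒allVariables V e)

  zeros≡suc⇒insertable : ∀ {k} (V : Vec Bool k) m → zeros (Vec.toList V) ≡ suc m →
    ∃[ i ] Vec.lookup V i ≡ false × zeros (Vec.toList (V Vec.[ i ]≔ true)) ≡ m
  zeros≡suc⇒insertable (false ∷ V) m e = Fin.zero , refl , ℕP.suc-injective e
  zeros≡suc⇒insertable (true ∷ V) m e with zeros≡suc⇒insertable V m e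
  ... | i , Vi≡0 , e′ = Fin.suc i , Vi≡0 , e′

  -- Induction on the number m of missing variables; for m = 0 divide mulLinear-elementary by d + 1 ≠ 0.
  elementary-linearMultiple : CharZero K → ∀ {k} m d (V : Vec Bool k) → zeros (Vec.toList V) ≡ m → m ≤ d →
                              LinearMultiple (elementary V (suc d))
  elementary-linearMultiple char0 zero d V V-full _ with zeros≡0⇒allVariables V V-full
  ... | refl with inverse (natK K (suc d)) (char0 d)
  ... | d+1⁻¹ , inv = (λ T → d+1⁻¹ * elementary (allVariables _) d T) , λ T → ≈-sym (cancel T)
    where
    cancel : ∀ T → mulLinear (λ U → d+1⁻¹ * elementary (allVariables _) d U) T ≈ elementary (allVariables _) (suc d) T
    cancel T = begin
      mulLinear (λ U → d+1⁻¹ * elementary (allVariables _) d U) T ≈⟨ mulLinear-*ˡ d+1⁻¹ _ T ⟩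
      d+1⁻¹ * mulLinear (elementary (allVariables _) d) T         ≈⟨ *-cong ≈-refl (mulLinear-elementary d T) ⟩
      d+1⁻¹ * (natK K (suc d) * e)                                ≈⟨ *-assoc _ _ _ ⟨
      (d+1⁻¹ * natK K (suc d)) * e                                ≈⟨ *-cong (≈-trans (*-comm _ _) inv) ≈-refl ⟩
      1# * e                                                      ≈⟨ *-identityˡ e ⟩
      e                                                           ∎
      where e = elementary (allVariables _) (suc d) T
  elementary-linearMultiple char0 (suc m) (suc d) V V-zeros (s≤s m≤d) with zeros≡suc⇒insertable V m V-zeros
  ... | i , Vi≡0 , V′-zeros =
    linearMultiple-resp (elementary-insert i V Vi≡0 (suc d))
      (linearMultiple-sub (elementary-linearMultiple char0 m (suc d) V′ V′-zeros (ℕP.m≤n⇒m≤1+n m≤d))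
                          (linearMultiple-mulMonomial (singleton i)
                            (elementary-linearMultiple char0 m d V′ V′-zeros m≤d)))
    where V′ = V Vec.[ i ]≔ true

module BallotReduction {c ℓ} (K : Field c ℓ) where
  open Field K hiding (zero) renaming (refl to ≈-refl; sym to ≈-sym; trans to ≈-trans; reflexive to ≈-reflexive)
  open import Algebra.Properties.Ring ring using (-1*x≈-x; ⁻¹-anti-homo‿-)
  open import Algebra.Properties.CommutativeSemigroup +-commutativeSemigroup using (interchange)
  open import Relation.Binary.Reasoning.Setoid setoid
  open import Induction.WellFounded using (module All)
  open Bitstrings
  open FiniteSums K
  open SquareFreeQuotient K

  Ballot : ℕ → Set
  Ballot k = Σ (Vec Bool k) (λ γ → StaysAbove (Vec.toList γ))

  ballotCombination : ∀ {k} → List (Carrier × Ballot k) → SqFree k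
  ballotCombination cs T = ∑[ x ∈ cs ] (proj₁ x * basis (proj₁ (proj₂ x)) T)

  BallotReducible : ∀ {k} → SqFree k → Set (c ⊔ ℓ)
  BallotReducible {k} f = ∃[ cs ] ∃[ g ] ∀ T → f T ≈ ballotCombination cs T + mulLinear g T

  ballotReducible-resp : ∀ {k} {f f′ : SqFree k} → (∀ T → f T ≈ f′ T) → BallotReducible f′ → BallotReducible f
  ballotReducible-resp f≈f′ (cs , g , p) = cs , g , λ T → ≈-trans (f≈f′ T) (p T)

  ballotReducible-zero : ∀ {k} {f : SqFree k} → (∀ T → f T ≈ 0#) → BallotReducible f
  ballotReducible-zero f≈0 = [] , (λ _ → 0#) , λ T →
    ≈-trans (f≈0 T) (≈-sym (≈-trans (+-identityˡ _) (mulLinear-zero (λ _ → ≈-refl) T)))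

  ballotReducible-linearMultiple : ∀ {k} {f : SqFree k} → LinearMultiple f → BallotReducible f
  ballotReducible-linearMultiple (g , p) = [] , g , λ T → ≈-trans (p T) (≈-sym (+-identityˡ _))

  ballotReducible-basis : ∀ {k} (γ : Ballot k) → BallotReducible (basis (proj₁ γ))
  ballotReducible-basis γ = ((1# , γ) ∷ []) , (λ _ → 0#) , λ T → ≈-sym (begin
    (1# * basis (proj₁ γ) T + 0#) + mulLinear (λ _ → 0#) T
      ≈⟨ +-cong (+-identityʳ _) (mulLinear-zero (λ _ → ≈-refl) T) ⟩
    1# * basis (proj₁ γ) T + 0# ≈⟨ +-identityʳ _ ⟩
    1# * basis (proj₁ γ) T      ≈⟨ *-identityˡ _ ⟩
    basis (proj₁ γ) T           ∎)

  ballotReducible-+ : ∀ {k} {f h : SqFree k} → BallotReducible f → BallotReducible h → BallotReducible (λ T → f T + h T)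
  ballotReducible-+ (cs₁ , g₁ , p₁) (cs₂ , g₂ , p₂) = cs₁ ++ cs₂ , (λ T → g₁ T + g₂ T) , λ T → begin
    _ + _                                                                   ≈⟨ +-cong (p₁ T) (p₂ T) ⟩
    (ballotCombination cs₁ T + mulLinear g₁ T) + (ballotCombination cs₂ T + mulLinear g₂ T) ≈⟨ interchange _ _ _ _ ⟩
    (ballotCombination cs₁ T + ballotCombination cs₂ T) + (mulLinear g₁ T + mulLinear g₂ T)
      ≈⟨ +-cong (∑-++ cs₁ cs₂ _) (mulLinear-+ g₁ g₂ T) ⟨
    ballotCombination (cs₁ ++ cs₂) T + mulLinear (λ U → g₁ U + g₂ U) T        ∎

  ballotReducible-*ˡ : ∀ {k} a {f : SqFree k} → BallotReducible f → BallotReducible (λ T → a * f T)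
  ballotReducible-*ˡ a (cs , g , p) = List.map (λ x → a * proj₁ x , proj₂ x) cs , (λ T → a * g T) , λ T → begin
    a * _                                                   ≈⟨ *-cong ≈-refl (p T) ⟩
    a * (ballotCombination cs T + mulLinear g T)            ≈⟨ distribˡ a _ _ ⟩
    a * ballotCombination cs T + a * mulLinear g T          ≈⟨ +-cong (∑-*ˡ cs a _) (mulLinear-*ˡ a g T) ⟨
    ∑[ x ∈ cs ] (a * (proj₁ x * basis (proj₁ (proj₂ x)) T)) + mulLinear (λ U → a * g U) T
      ≈⟨ +-cong (∑-cong cs (λ x → *-assoc _ _ _)) ≈-refl ⟨
    ∑[ x ∈ cs ] ((a * proj₁ x) * basis (proj₁ (proj₂ x)) T) + mulLinear (λ U → a * g U) T
      ≡⟨ ≡.cong (_+ _) (∑-map _ cs _) ⟨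
    ballotCombination (List.map (λ x → a * proj₁ x , proj₂ x) cs) T + mulLinear (λ U → a * g U) T ∎

  ballotReducible-sub : ∀ {k} {f h : SqFree k} → BallotReducible f → BallotReducible h →
                        BallotReducible (λ T → f T - h T)
  ballotReducible-sub rf rh =
    ballotReducible-resp (λ T → +-cong ≈-refl (≈-sym (-1*x≈-x _))) (ballotReducible-+ rf (ballotReducible-*ˡ (- 1#) rh))

  ballotReducible-∑ : ∀ {a} {A : Set a} {k} (xs : List A) {F : A → SqFree k} →
                      (∀ x → BallotReducible (F x)) → BallotReducible (λ T → ∑[ x ∈ xs ] F x T)
  ballotReducible-∑ [] _ = ballotReducible-zero (λ _ → ≈-refl)
  ballotReducible-∑ (x ∷ xs) r = ballotReducible-+ (r x) (ballotReducible-∑ xs r)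

  mulMonomial-unit-support : ∀ {k} (S V T : Vec Bool k) → mulMonomial S (elementary V 0) T ≈ 0# ⊎ T ≡ S
  mulMonomial-unit-support [] [] [] = inj₂ refl
  mulMonomial-unit-support (false ∷ S) (v ∷ V) (false ∷ T) with mulMonomial-unit-support S V T
  ... | inj₁ p = inj₁ p
  ... | inj₂ T≡S = inj₂ (≡.cong (false ∷_) T≡S)
  mulMonomial-unit-support (false ∷ S) (v ∷ V) (true ∷ T) = inj₁ (mulMonomial-zero S (λ _ → ≈-refl) T)
  mulMonomial-unit-support (true ∷ S) (v ∷ V) (true ∷ T) with mulMonomial-unit-support S V T
  ... | inj₁ p = inj₁ p
  ... | inj₂ T≡S = inj₂ (≡.cong (true ∷_) T≡S)
  mulMonomial-unit-support (true ∷ S) (v ∷ V) (false ∷ T) = inj₁ ≈-refl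

  mulMonomial-unit-self : ∀ {k} (S V : Vec Bool k) → mulMonomial S (elementary V 0) S ≈ 1#
  mulMonomial-unit-self [] [] = ≈-refl
  mulMonomial-unit-self (false ∷ S) (v ∷ V) = mulMonomial-unit-self S V
  mulMonomial-unit-self (true ∷ S) (v ∷ V) = mulMonomial-unit-self S V

  -- Expanding the product, every monomial replaces ones of T₁…T_j by later variables, so y^T is the
  -- lex-largest monomial, with coefficient 1.
  descentReducer : ∀ {k} → ℕ → Vec Bool k → SqFree k
  descentReducer j T = mulMonomial (clearPrefix j T) (elementary (fillSuffix j T) (onesInPrefix j T))

  descentReducer-support : ∀ {k} j (T U : Vec Bool k) → descentReducer j T U ≈ 0# ⊎ U ≺ T ⊎ U ≡ T
  descentReducer-support zero T U with mulMonomial-unit-support T (allVariables _) U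
  ... | inj₁ p = inj₁ p
  ... | inj₂ U≡T = inj₂ (inj₂ U≡T)
  descentReducer-support (suc j) [] [] = inj₂ (inj₂ refl)
  descentReducer-support (suc j) (false ∷ T) (false ∷ U) with descentReducer-support j T U
  ... | inj₁ p = inj₁ p
  ... | inj₂ (inj₁ U≺T) = inj₂ (inj₁ (next refl U≺T))
  ... | inj₂ (inj₂ U≡T) = inj₂ (inj₂ (≡.cong (false ∷_) U≡T))
  descentReducer-support (suc j) (true ∷ T) (false ∷ U) = inj₂ (inj₁ (this Bool.f<t refl))
  descentReducer-support (suc j) (false ∷ T) (true ∷ U) =
    inj₁ (mulMonomial-zero (clearPrefix j T) (λ V → elementary-outside (fillSuffix j T) (onesInPrefix j T) V) U)
  descentReducer-support (suc j) (true ∷ T) (true ∷ U) with descentReducer-support j T U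
  ... | inj₁ p = inj₁ p
  ... | inj₂ (inj₁ U≺T) = inj₂ (inj₁ (next refl U≺T))
  ... | inj₂ (inj₂ U≡T) = inj₂ (inj₂ (≡.cong (true ∷_) U≡T))

  descentReducer-self : ∀ {k} j (T : Vec Bool k) → descentReducer j T T ≈ 1#
  descentReducer-self zero T = mulMonomial-unit-self T (allVariables _)
  descentReducer-self (suc j) [] = ≈-refl
  descentReducer-self (suc j) (false ∷ T) = descentReducer-self j T
  descentReducer-self (suc j) (true ∷ T) = descentReducer-self j T

  -- At a first descent w1 the elementary factor has degree ones w + 1 and misses only zeros w = ones w variables.
  descentReducer-linearMultiple : CharZero K → ∀ {k} (T : Vec Bool k) → (d : FirstDescent 0 (Vec.toList T)) →
    LinearMultiple (descentReducer (suc (List.length (proj₁ d))) T)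
  descentReducer-linearMultiple char0 T (w , v , T≡w1v , balanced , _) =
    linearMultiple-mulMonomial (clearPrefix j T)
      (≡.subst (λ o → LinearMultiple (elementary (fillSuffix j T) o)) (≡.sym (onesInPrefix-descent w v T T≡w1v))
        (elementary-linearMultiple char0 _ (ones w) (fillSuffix j T) refl
          (ℕP.≤-reflexive (≡.trans (zeros-fillSuffix-descent w v T T≡w1v)
                                   (≡.trans (≡.sym (ℕP.+-identityʳ (zeros w))) balanced)))))
    where j = suc (List.length w)

  x-[x-y]≈y : ∀ x y → x - (x - y) ≈ y
  x-[x-y]≈y x y = begin
    x - (x - y)    ≈⟨ +-cong ≈-refl (⁻¹-anti-homo‿- x y) ⟩
    x + (y - x)    ≈⟨ +-comm x _ ⟩
    (y - x) + x    ≈⟨ +-assoc y (- x) x ⟩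
    y + (- x + x)  ≈⟨ +-cong ≈-refl (-‿inverseˡ x) ⟩
    y + 0#         ≈⟨ +-identityʳ y ⟩
    y              ∎

  module _ (char0 : CharZero K) where

    ballotReducible-below : ∀ {k} (T : Vec Bool k) →
      (∀ {U} → U ≺ T → BallotReducible (basis U)) → {f : SqFree k} → (∀ U → f U ≈ 0# ⊎ U ≺ T) → BallotReducible f
    ballotReducible-below {k} T ih {f} f-below =
      ballotReducible-resp (λ U → ≈-sym (∑-basis f U)) (ballotReducible-∑ (allBits k) term)
      where
      term : ∀ S → BallotReducible (λ U → f S * basis S U)
      term S with f-below S
      ... | inj₁ fS≈0 = ballotReducible-zero (λ U → ≈-trans (*-cong fS≈0 ≈-refl) (zeroˡ _))
      ... | inj₂ S≺T = ballotReducible-*ˡ (f S) (ih S≺T)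

    basis-ballotReducible : ∀ {k} (T : Vec Bool k) → BallotReducible (basis T)
    basis-ballotReducible = All.wfRec ≺-wellFounded _ (λ T → BallotReducible (basis T)) reduce
      where
      reduce : ∀ {k} (T : Vec Bool k) → (∀ {U} → U ≺ T → BallotReducible (basis U)) → BallotReducible (basis T)
      reduce T ih with staysAboveFrom? 0 (Vec.toList T)
      ... | inj₁ above = ballotReducible-basis (T , staysAboveFrom0⇒staysAbove _ above)
      ... | inj₂ d = ballotReducible-resp (λ U → ≈-sym (x-[x-y]≈y (Q U) (basis T U)))
                       (ballotReducible-sub (ballotReducible-linearMultiple (descentReducer-linearMultiple char0 T d))
                                            (ballotReducible-below T ih rest-below))
        where
        j = suc (List.length (proj₁ d))
        Q = descentReducer j T
        rest-below : ∀ U → Q U - basis T U ≈ 0# ⊎ U ≺ T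
        rest-below U with ≡-dec BoolP._≟_ U T
        ... | yes refl = inj₁ (≈-trans (+-cong (descentReducer-self j T) (-‿cong (≈-reflexive (basis-self T))))
                                       (-‿inverseʳ 1#))
        ... | no U≢T with descentReducer-support j T U
        ...   | inj₁ QU≈0 = inj₁ (≈-trans (+-cong QU≈0 (-‿cong (≈-reflexive (basis-≢ (λ T≡U → U≢T (≡.sym T≡U))))))
                                          (-‿inverseʳ 0#))
        ...   | inj₂ (inj₁ U≺T) = inj₂ U≺T
        ...   | inj₂ (inj₂ U≡T) = ⊥-elim (U≢T U≡T)

module MonomialArithmetic {c ℓ} (K : Field c ℓ) where
  open Field K hiding (zero) renaming (refl to ≈-refl; sym to ≈-sym; trans to ≈-trans; reflexive to ≈-reflexive)
  open import Relation.Binary.Reasoning.Setoid setoid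
  open module PolyK {k : ℕ} = Poly K k using (Mon; mono; shift; toExp; e; _∣M_)
  open FiniteSums K
  open SquareFreeQuotient K

  +ᵛ-∸ᵛ-cancel : ∀ {k} {a m : Mon {k}} → a ∣M m → Vec.zipWith _+ℕ_ a (Vec.zipWith _∸_ m a) ≡ m
  +ᵛ-∸ᵛ-cancel PW.[] = refl
  +ᵛ-∸ᵛ-cancel (x≤y PW.∷ a∣m) = ≡.cong₂ _∷_ (ℕP.m+[n∸m]≡n x≤y) (+ᵛ-∸ᵛ-cancel a∣m)

  ∸ᵛ-+ᵛ-cancel : ∀ {k} (a b : Mon {k}) → Vec.zipWith _∸_ (Vec.zipWith _+ℕ_ a b) a ≡ b
  ∸ᵛ-+ᵛ-cancel [] [] = refl
  ∸ᵛ-+ᵛ-cancel (x ∷ a) (y ∷ b) = ≡.cong₂ _∷_ (ℕP.m+n∸m≡n x y) (∸ᵛ-+ᵛ-cancel a b)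

  ∣M-+ᵛ : ∀ {k} (a b : Mon {k}) → a ∣M Vec.zipWith _+ℕ_ a b
  ∣M-+ᵛ [] [] = PW.[]
  ∣M-+ᵛ (x ∷ a) (y ∷ b) = ℕP.m≤m+n x y PW.∷ ∣M-+ᵛ a b

  +ᵛ-identityʳ : ∀ {k} (a : Mon {k}) → Vec.zipWith _+ℕ_ a (Vec.replicate k 0) ≡ a
  +ᵛ-identityʳ [] = refl
  +ᵛ-identityʳ (x ∷ a) = ≡.cong₂ _∷_ (ℕP.+-identityʳ x) (+ᵛ-identityʳ a)

  shift-mono : ∀ {k} (a b m : Mon {k}) → shift a (mono b) m ≈ mono (Vec.zipWith _+ℕ_ a b) m
  shift-mono a b m with PW.decidable ℕP._≤?_ a m | ≡-dec ℕP._≟_ (Vec.zipWith _∸_ m a) b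
                      | ≡-dec ℕP._≟_ m (Vec.zipWith _+ℕ_ a b)
  ... | yes _ | yes _ | yes _ = ≈-refl
  ... | yes a∣m | yes m-a≡b | no m≢a+b =
    ⊥-elim (m≢a+b (≡.trans (≡.sym (+ᵛ-∸ᵛ-cancel a∣m)) (≡.cong (Vec.zipWith _+ℕ_ a) m-a≡b)))
  ... | yes _ | no m-a≢b | yes refl = ⊥-elim (m-a≢b (∸ᵛ-+ᵛ-cancel a b))
  ... | yes _ | no _ | no _ = ≈-refl
  ... | no a∤m | _ | yes refl = ⊥-elim (a∤m (∣M-+ᵛ a b))
  ... | no _ | _ | no _ = ≈-refl

  shift-cong : ∀ {k} (a : Mon {k}) {p q : Mon → Carrier} → (∀ m → p m ≈ q m) → ∀ m → shift a p m ≈ shift a q m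
  shift-cong a p≈q m with does (PW.decidable ℕP._≤?_ a m)
  ... | true = p≈q _
  ... | false = ≈-refl

  shift-+ : ∀ {k} (a : Mon {k}) p q m → shift a (λ m′ → p m′ + q m′) m ≈ shift a p m + shift a q m
  shift-+ a p q m with does (PW.decidable ℕP._≤?_ a m)
  ... | true = ≈-refl
  ... | false = ≈-sym (+-identityʳ 0#)

  shift-*ˡ : ∀ {k} (a : Mon {k}) x p m → shift a (λ m′ → x * p m′) m ≈ x * shift a p m
  shift-*ˡ a x p m with does (PW.decidable ℕP._≤?_ a m)
  ... | true = ≈-refl
  ... | false = ≈-sym (zeroʳ x)

  shift-zero : ∀ {k} (a : Mon {k}) m → shift a (λ _ → 0#) m ≈ 0#
  shift-zero a m with does (PW.decidable ℕP._≤?_ a m)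
  ... | true = ≈-refl
  ... | false = ≈-refl

  mono-toExp : ∀ {k} (S T : Vec Bool k) → mono (toExp S) (toExp T) ≡ basis S T
  mono-toExp [] [] = refl
  mono-toExp (false ∷ S) (false ∷ T) = mono-toExp S T
  mono-toExp (false ∷ S) (true ∷ T) = refl
  mono-toExp (true ∷ S) (false ∷ T) = refl
  mono-toExp (true ∷ S) (true ∷ T) = mono-toExp S T

  shift-one : ∀ {k} (S T : Vec Bool k) → shift (toExp S) (mono (Vec.replicate k 0)) (toExp T) ≈ basis S T
  shift-one S T = ≈-trans (shift-mono (toExp S) _ (toExp T))
    (≈-reflexive (≡.trans (≡.cong (λ a → mono a (toExp T)) (+ᵛ-identityʳ (toExp S))) (mono-toExp S T)))

  ∑-allFin-suc : ∀ k (f : Fin (suc k) → Carrier) →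
                 ∑ (List.allFin (suc k)) f ≡ f Fin.zero + ∑[ i ∈ List.allFin k ] f (Fin.suc i)
  ∑-allFin-suc k f = ≡.cong (f Fin.zero +_)
    (≡.trans (≡.cong (λ is → ∑ is f) (≡.sym (ListP.map-tabulate (λ i → i) Fin.suc))) (∑-map Fin.suc (List.allFin k) f))

  linearForm : ∀ k → Mon {k} → Carrier
  linearForm k m = ∑[ i ∈ List.allFin k ] mono (e i) m

  linearForm-0∷ : ∀ {k} (m : Mon {k}) → linearForm (suc k) (0 ∷ m) ≈ linearForm k m
  linearForm-0∷ {k} m = ≈-trans (≈-reflexive (∑-allFin-suc k (λ i → mono (e i) (0 ∷ m)))) (+-identityˡ _)

  linearForm-1∷ : ∀ {k} (m : Mon {k}) → linearForm (suc k) (1 ∷ m) ≈ mono (Vec.replicate k 0) m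
  linearForm-1∷ {k} m = begin
    linearForm (suc k) (1 ∷ m)                            ≡⟨ ∑-allFin-suc k (λ i → mono (e i) (1 ∷ m)) ⟩
    mono (Vec.replicate k 0) m + ∑[ i ∈ List.allFin k ] 0# ≈⟨ +-cong ≈-refl (∑-zero (List.allFin k) (λ _ → ≈-refl)) ⟩
    mono (Vec.replicate k 0) m + 0#                       ≈⟨ +-identityʳ _ ⟩
    mono (Vec.replicate k 0) m                            ∎

  shift-linearForm : ∀ {k} (S T : Vec Bool k) → shift (toExp S) (linearForm k) (toExp T) ≈ mulLinear (basis S) T
  shift-linearForm [] [] = ≈-refl
  shift-linearForm (false ∷ S) (false ∷ T) = ≈-trans (shift-cong (toExp S) linearForm-0∷ (toExp T))
    (≈-trans (shift-linearForm S T) (≈-sym (+-identityˡ _)))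
  shift-linearForm (false ∷ S) (true ∷ T) = begin
    shift (toExp S) (λ m → linearForm _ (1 ∷ m)) (toExp T) ≈⟨ shift-cong (toExp S) linearForm-1∷ (toExp T) ⟩
    shift (toExp S) (mono (Vec.replicate _ 0)) (toExp T)   ≈⟨ shift-one S T ⟩
    basis S T                                             ≈⟨ +-identityʳ _ ⟨
    basis S T + 0#                                        ≈⟨ +-cong ≈-refl (mulLinear-zero (λ _ → ≈-refl) T) ⟨
    basis S T + mulLinear (λ U → basis (false ∷ S) (true ∷ U)) T ∎
  shift-linearForm (true ∷ S) (false ∷ T) = ≈-sym (≈-trans (+-identityˡ _) (mulLinear-zero (λ _ → ≈-refl) T))
  shift-linearForm (true ∷ S) (true ∷ T) = ≈-trans (shift-cong (toExp S) linearForm-0∷ (toExp T))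
    (≈-trans (shift-linearForm S T) (≈-sym (+-identityˡ _)))

  record HasSquare {k} (m : Mon {k}) : Set where
    constructor square-at
    field
      index : Fin k
      two≤ : 2 ≤ Vec.lookup m index

  squareFree? : ∀ {k} (m : Mon {k}) → (∃[ T ] m ≡ toExp T) ⊎ HasSquare m
  squareFree? [] = inj₁ ([] , refl)
  squareFree? (0 ∷ m) with squareFree? m
  ... | inj₁ (T , m≡T) = inj₁ (false ∷ T , ≡.cong (0 ∷_) m≡T)
  ... | inj₂ (square-at i 2≤mᵢ) = inj₂ (square-at (Fin.suc i) 2≤mᵢ)
  squareFree? (1 ∷ m) with squareFree? m
  ... | inj₁ (T , m≡T) = inj₁ (true ∷ T , ≡.cong (1 ∷_) m≡T)
  ... | inj₂ (square-at i 2≤mᵢ) = inj₂ (square-at (Fin.suc i) 2≤mᵢ)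
  squareFree? (suc (suc x) ∷ m) = inj₂ (square-at Fin.zero (s≤s (s≤s z≤n)))

  lookup-toExp≤1 : ∀ {k} (T : Vec Bool k) i → Vec.lookup (toExp T) i ≤ 1
  lookup-toExp≤1 (false ∷ T) Fin.zero = z≤n
  lookup-toExp≤1 (true ∷ T) Fin.zero = s≤s z≤n
  lookup-toExp≤1 (t ∷ T) (Fin.suc i) = lookup-toExp≤1 T i

  hasSquare⇒≢toExp : ∀ {k} {m : Mon {k}} → HasSquare m → ∀ T → m ≢ toExp T
  hasSquare⇒≢toExp (square-at i 2≤mᵢ) T refl with ℕP.≤-trans 2≤mᵢ (lookup-toExp≤1 T i)
  ... | s≤s ()

  mono-hasSquare : ∀ {k} {m : Mon {k}} → HasSquare m → ∀ T → mono (toExp T) m ≈ 0#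
  mono-hasSquare {m = m} sq T = ≈-reflexive (≡.cong 𝟙 (dec-false (≡-dec ℕP._≟_ m (toExp T)) (hasSquare⇒≢toExp sq T)))

  mono-toExp-hasSquare : ∀ {k} {m : Mon {k}} → HasSquare m → ∀ T → mono m (toExp T) ≈ 0#
  mono-toExp-hasSquare {m = m} sq T =
    ≈-reflexive (≡.cong 𝟙 (dec-false (≡-dec ℕP._≟_ (toExp T) m) (λ T≡m → hasSquare⇒≢toExp sq T (≡.sym T≡m))))

  square : ∀ {k} → Fin k → Mon {k}
  square {k} i = Vec.replicate k 0 Vec.[ i ]≔ 2

  replicate-0-∣M : ∀ {k} (m : Mon {k}) → Vec.replicate k 0 ∣M m
  replicate-0-∣M [] = PW.[]
  replicate-0-∣M (x ∷ m) = z≤n PW.∷ replicate-0-∣M m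

  square-∣M : ∀ {k} (m : Mon {k}) i → 2 ≤ Vec.lookup m i → square i ∣M m
  square-∣M (x ∷ m) Fin.zero 2≤x = 2≤x PW.∷ replicate-0-∣M m
  square-∣M (x ∷ m) (Fin.suc i) 2≤mᵢ = z≤n PW.∷ square-∣M m i 2≤mᵢ

  divide-square : ∀ {k} (m : Mon {k}) i → 2 ≤ Vec.lookup m i →
                  Vec.zipWith _+ℕ_ (m Vec.[ i ]≔ (Vec.lookup m i ∸ 2)) (square i) ≡ m
  divide-square (x ∷ m) Fin.zero 2≤x = ≡.cong₂ _∷_ (ℕP.m∸n+n≡m 2≤x) (+ᵛ-identityʳ m)
  divide-square (x ∷ m) (Fin.suc i) 2≤mᵢ = ≡.cong₂ _∷_ (ℕP.+-identityʳ x) (divide-square m i 2≤mᵢ)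

module QuotientRing {c ℓ} (K : Field c ℓ) (n : ℕ) where
  open Field K hiding (zero) renaming (refl to ≈-refl; sym to ≈-sym; trans to ≈-trans; reflexive to ≈-reflexive)
  open import Algebra.Properties.Ring ring using (-1*x≈-x; -0#≈0#; -‿+-comm; x[y-z]≈xy-xz; xyx⁻¹≈y; //-rightDividesˡ)
  open import Algebra.Properties.CommutativeSemigroup +-commutativeSemigroup using (interchange)
  open import Relation.Binary.Reasoning.Setoid setoid
  open Poly K n
  open FiniteSums K
  open SquareFreeQuotient K
  open MonomialArithmetic K
  open BallotReduction K

  sumP-apply : ∀ {a} {A : Set a} (xs : List A) (F : A → Pol) m → sumP (List.map F xs) m ≡ ∑[ x ∈ xs ] F x m
  sumP-apply [] F m = refl
  sumP-apply (x ∷ xs) F m = ≡.cong (F x m +_) (sumP-apply xs F m)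

  InI : Pol → Set (c ⊔ ℓ)
  InI = InIdeal GenI

  inI-resp : ∀ {p q} → p ≈P q → InI q → InI p
  inI-resp p≈q (r , comb , q≈r) = r , comb , λ m → ≈-trans (p≈q m) (q≈r m)

  inI-zero : ∀ {p} → (∀ m → p m ≈ 0#) → InI p
  inI-zero p≈0 = 0P , nil , p≈0

  comb-+ : ∀ {q₁ q₂} → Comb GenI q₁ → Comb GenI q₂ → ∃[ q ] Comb GenI q × (q₁ +P q₂) ≈P q
  comb-+ nil comb₂ = _ , comb₂ , λ m → +-identityˡ _
  comb-+ (cons h k a comb₁) comb₂ with comb-+ comb₁ comb₂
  ... | q , comb , eq = _ , cons h k a comb , λ m → ≈-trans (+-assoc _ _ _) (+-cong ≈-refl (eq m))

  comb-*ˡ : ∀ a {q} → Comb GenI q → ∃[ q′ ] Comb GenI q′ × (a ·P q) ≈P q′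
  comb-*ˡ a nil = _ , nil , λ m → zeroʳ a
  comb-*ˡ a (cons h k b comb) with comb-*ˡ a comb
  ... | q , comb′ , eq =
    _ , cons h (a * k) b comb′ , λ m → ≈-trans (distribˡ a _ _) (+-cong (≈-sym (*-assoc _ _ _)) (eq m))

  inI-+ : ∀ {p q} → InI p → InI q → InI (p +P q)
  inI-+ (q₁ , comb₁ , p≈q₁) (q₂ , comb₂ , q≈q₂) with comb-+ comb₁ comb₂
  ... | q , comb , eq = q , comb , λ m → ≈-trans (+-cong (p≈q₁ m) (q≈q₂ m)) (eq m)

  inI-*ˡ : ∀ a {p} → InI p → InI (a ·P p)
  inI-*ˡ a (q , comb , p≈q) with comb-*ˡ a comb
  ... | q′ , comb′ , eq = q′ , comb′ , λ m → ≈-trans (*-cong ≈-refl (p≈q m)) (eq m)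

  inI-hasSquare : ∀ a {m} → HasSquare m → InI (term a m)
  inI-hasSquare a {m} (square-at i 2≤mᵢ) = _ , cons (sq i) a (m Vec.[ i ]≔ (Vec.lookup m i ∸ 2)) nil , λ m′ →
    ≈-sym (≈-trans (+-identityʳ _) (*-cong ≈-refl (≈-trans (shift-mono _ _ m′)
      (≈-reflexive (≡.cong (λ m″ → mono m″ m′) (divide-square m i 2≤mᵢ))))))

  LinearCombination : {A : Set} → (A → Mon) → Pol → Set (c ⊔ ℓ)
  LinearCombination {A} mon p = ∃[ cs ] p ≈P sumP (List.map (λ (x : Carrier × A) → term (proj₁ x) (mon (proj₂ x))) cs)

  module _ {A : Set} (mon : A → Mon) where
    private
      termOf : Carrier × A → Pol
      termOf x = term (proj₁ x) (mon (proj₂ x))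

    linearCombination-resp : ∀ {p q} → p ≈P q → LinearCombination mon q → LinearCombination mon p
    linearCombination-resp p≈q (cs , q≈) = cs , λ m → ≈-trans (p≈q m) (q≈ m)

    linearCombination-zero : LinearCombination mon 0P
    linearCombination-zero = [] , λ m → ≈-refl

    linearCombination-+ : ∀ {p q} → LinearCombination mon p → LinearCombination mon q → LinearCombination mon (p +P q)
    linearCombination-+ (cs₁ , p≈) (cs₂ , q≈) = cs₁ ++ cs₂ , λ m → begin
      _ + _                                                 ≈⟨ +-cong (p≈ m) (q≈ m) ⟩
      sumP (List.map termOf cs₁) m + sumP (List.map termOf cs₂) m
        ≡⟨ ≡.cong₂ _+_ (sumP-apply cs₁ termOf m) (sumP-apply cs₂ termOf m) ⟩
      ∑[ x ∈ cs₁ ] termOf x m + ∑[ x ∈ cs₂ ] termOf x m      ≈⟨ ∑-++ cs₁ cs₂ _ ⟨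
      ∑[ x ∈ cs₁ ++ cs₂ ] termOf x m                        ≡⟨ sumP-apply (cs₁ ++ cs₂) termOf m ⟨
      sumP (List.map termOf (cs₁ ++ cs₂)) m                 ∎

    linearCombination-*ˡ : ∀ a {p} → LinearCombination mon p → LinearCombination mon (a ·P p)
    linearCombination-*ˡ a (cs , p≈) = List.map scale cs , λ m → begin
      a * _                                       ≈⟨ *-cong ≈-refl (p≈ m) ⟩
      a * sumP (List.map termOf cs) m             ≡⟨ ≡.cong (a *_) (sumP-apply cs termOf m) ⟩
      a * ∑[ x ∈ cs ] termOf x m                   ≈⟨ ∑-*ˡ cs a _ ⟨
      ∑[ x ∈ cs ] (a * termOf x m)                 ≈⟨ ∑-cong cs (λ x → ≈-sym (*-assoc _ _ _)) ⟩
      ∑[ x ∈ cs ] termOf (scale x) m               ≡⟨ ∑-map scale cs (λ x → termOf x m) ⟨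
      ∑[ x ∈ List.map scale cs ] termOf x m        ≡⟨ sumP-apply (List.map scale cs) termOf m ⟨
      sumP (List.map termOf (List.map scale cs)) m ∎
      where
      scale : Carrier × A → Carrier × A
      scale x = a * proj₁ x , proj₂ x

    linearCombination-sub : ∀ {p q} → LinearCombination mon p → LinearCombination mon q → LinearCombination mon (p -P q)
    linearCombination-sub lp lq = linearCombination-resp (λ m → +-cong ≈-refl (≈-sym (-1*x≈-x _)))
      (linearCombination-+ lp (linearCombination-*ˡ (- 1#) lq))

    linearCombination-sumP : ∀ {b} {B : Set b} (xs : List B) {F : B → Pol} →
      (∀ x → LinearCombination mon (F x)) → LinearCombination mon (sumP (List.map F xs))
    linearCombination-sumP [] _ = linearCombination-zero
    linearCombination-sumP (x ∷ xs) lF = linearCombination-+ (lF x) (linearCombination-sumP xs lF)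

  FinitePoly : Pol → Set (c ⊔ ℓ)
  FinitePoly = LinearCombination id

  private
    monomialTerm : Carrier × Mon → Pol
    monomialTerm x = term (proj₁ x) (proj₂ x)

  finitePoly-term : ∀ a m → FinitePoly (term a m)
  finitePoly-term a m = ((a , m) ∷ []) , λ m′ → ≈-sym (+-identityʳ _)

  finitePoly-shift : ∀ a {p} → FinitePoly p → FinitePoly (shift a p)
  finitePoly-shift a (cs , p≈) = linearCombination-resp id (shift-cong a p≈) (shiftSum cs)
    where
    shiftSum : ∀ cs → FinitePoly (shift a (sumP (List.map monomialTerm cs)))
    shiftSum [] = linearCombination-resp id (shift-zero a) (linearCombination-zero id)
    shiftSum ((x , m) ∷ cs) =
      linearCombination-resp id distribute (linearCombination-+ id (finitePoly-term x _) (shiftSum cs))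
      where
      rest = sumP (List.map monomialTerm cs)
      distribute : shift a (term x m +P rest) ≈P (term x (Vec.zipWith _+ℕ_ a m) +P shift a rest)
      distribute m′ = ≈-trans (shift-+ a (term x m) rest m′)
        (+-cong (≈-trans (shift-*ˡ a x (mono m) m′) (*-cong ≈-refl (shift-mono a m m′))) ≈-refl)

  linearGenerator : Pol
  linearGenerator = sumP (List.map (λ i → mono (e i)) (List.allFin n))

  linearGenerator-apply : ∀ m → linearGenerator m ≡ linearForm n m
  linearGenerator-apply = sumP-apply (List.allFin n) (λ i → mono (e i))

  finitePoly-linearGenerator : FinitePoly linearGenerator
  finitePoly-linearGenerator = linearCombination-sumP id (List.allFin n)
    (λ i → linearCombination-resp id (λ m → ≈-sym (*-identityˡ _)) (finitePoly-term 1# (e i)))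

  lift : SqFree n → Pol
  lift f m = ∑[ T ∈ allBits n ] (f T * mono (toExp T) m)

  lift-toExp : ∀ f S → lift f (toExp S) ≈ f S
  lift-toExp f S = ≈-trans (∑-cong (allBits n) (λ T → *-cong ≈-refl (≈-reflexive (mono-toExp T S)))) (∑-basis f S)

  lift-hasSquare : ∀ f {m} → HasSquare m → lift f m ≈ 0#
  lift-hasSquare f m-sq = ∑-zero (allBits n) (λ T → ≈-trans (*-cong ≈-refl (mono-hasSquare m-sq T)) (zeroʳ _))

  finitePoly-lift : ∀ f → FinitePoly (lift f)
  finitePoly-lift f = List.map coefficient (allBits n) , λ m → ≈-sym (≈-reflexive (≡.trans
    (sumP-apply (List.map coefficient (allBits n)) monomialTerm m)
    (∑-map coefficient (allBits n) (λ x → monomialTerm x m))))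
    where
    coefficient : Vec Bool n → Carrier × Mon
    coefficient T = f T , toExp T

  ≈P-bySquareFreeness : ∀ {p q : Pol} → (∀ S → p (toExp S) ≈ q (toExp S)) → (∀ m → HasSquare m → p m ≈ q m) → p ≈P q
  ≈P-bySquareFreeness onSquareFree onSquares m with squareFree? m
  ... | inj₁ (S , refl) = onSquareFree S
  ... | inj₂ m-sq = onSquares m m-sq

  -- the terms of Σ cs whose monomial contains a square
  squarePart : ∀ cs → ∃[ q ] InI q × (∀ S → q (toExp S) ≈ 0#) ×
                               (∀ m → HasSquare m → sumP (List.map monomialTerm cs) m ≈ q m)
  squarePart [] = 0P , inI-zero (λ _ → ≈-refl) , (λ _ → ≈-refl) , (λ _ _ → ≈-refl)
  squarePart ((a , v) ∷ cs) with squarePart cs | squareFree? v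
  ... | q , q∈I , q-sqfree , q-sq | inj₁ (T , refl) = q , q∈I , q-sqfree , λ m m-sq →
        ≈-trans (+-cong (≈-trans (*-cong ≈-refl (mono-hasSquare m-sq T)) (zeroʳ a)) (q-sq m m-sq)) (+-identityˡ _)
  ... | q , q∈I , q-sqfree , q-sq | inj₂ v-sq = term a v +P q , inI-+ (inI-hasSquare a v-sq) q∈I ,
        (λ S → ≈-trans (+-cong (≈-trans (*-cong ≈-refl (mono-toExp-hasSquare v-sq S)) (zeroʳ a)) (q-sqfree S))
                       (+-identityʳ 0#)) ,
        (λ m m-sq → +-cong ≈-refl (q-sq m m-sq))

  vanishesOnSquareFree⇒inI : ∀ {q} → FinitePoly q → (∀ S → q (toExp S) ≈ 0#) → InI q
  vanishesOnSquareFree⇒inI (cs , q≈) q-sqfree with squarePart cs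
  ... | r , r∈I , r-sqfree , r-sq =
    inI-resp (≈P-bySquareFreeness (λ S → ≈-trans (q-sqfree S) (≈-sym (r-sqfree S)))
                                  (λ m m-sq → ≈-trans (q≈ m) (r-sq m m-sq)))
             r∈I

  linearGeneratorMultiple : SqFree n → Pol
  linearGeneratorMultiple g = sumP (List.map (λ S → g S ·P shift (toExp S) linearGenerator) (allBits n))

  inI-linearGeneratorMultiple : ∀ g → InI (linearGeneratorMultiple g)
  inI-linearGeneratorMultiple g = _ , comb (allBits n) , λ m → ≈-refl
    where
    comb : ∀ Ss → Comb GenI (sumP (List.map (λ S → g S ·P shift (toExp S) linearGenerator) Ss))
    comb [] = nil
    comb (S ∷ Ss) = cons lin (g S) (toExp S) (comb Ss)

  linearGeneratorMultiple-toExp : ∀ g S → linearGeneratorMultiple g (toExp S) ≈ mulLinear g S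
  linearGeneratorMultiple-toExp g S = begin
    linearGeneratorMultiple g (toExp S)
      ≡⟨ sumP-apply (allBits n) _ (toExp S) ⟩
    ∑[ S′ ∈ allBits n ] (g S′ * shift (toExp S′) linearGenerator (toExp S))
      ≈⟨ ∑-cong (allBits n) (λ S′ → *-cong ≈-refl (≈-trans
           (shift-cong (toExp S′) (λ m → ≈-reflexive (linearGenerator-apply m)) (toExp S)) (shift-linearForm S′ S))) ⟩
    ∑[ S′ ∈ allBits n ] (g S′ * mulLinear (basis S′) S)
      ≈⟨ ∑-cong (allBits n) (λ S′ → mulLinear-*ˡ (g S′) (basis S′) S) ⟨
    ∑[ S′ ∈ allBits n ] mulLinear (λ T → g S′ * basis S′ T) S
      ≈⟨ mulLinear-∑ (allBits n) (λ S′ T → g S′ * basis S′ T) S ⟨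
    mulLinear (λ T → ∑[ S′ ∈ allBits n ] (g S′ * basis S′ T)) S
      ≈⟨ mulLinear-cong (∑-basis g) S ⟩
    mulLinear g S ∎

  -- lift (mulLinear g) and Σ_S g S y^S (y₁+⋯+yₙ) agree on square-free monomials, so they differ by squares
  inI-lift-mulLinear : ∀ g → InI (lift (mulLinear g))
  inI-lift-mulLinear g =
    inI-resp (λ m → ≈-sym (//-rightDividesˡ _ _)) (inI-+ (vanishesOnSquareFree⇒inI difference-finite difference-sqfree)
                                                  (inI-linearGeneratorMultiple g))
    where
    difference-finite : FinitePoly (lift (mulLinear g) -P linearGeneratorMultiple g)
    difference-finite = linearCombination-sub id (finitePoly-lift _)
      (linearCombination-sumP id (allBits n) (λ S →
        linearCombination-*ˡ id (g S) (finitePoly-shift (toExp S) finitePoly-linearGenerator)))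
    difference-sqfree : ∀ S → (lift (mulLinear g) -P linearGeneratorMultiple g) (toExp S) ≈ 0#
    difference-sqfree S = ≈-trans (+-cong (lift-toExp (mulLinear g) S) (-‿cong (linearGeneratorMultiple-toExp g S)))
                                  (-‿inverseʳ _)

  [x+y]-[u+v]≈[x-u]+[y-v] : ∀ x y u v → (x + y) - (u + v) ≈ (x - u) + (y - v)
  [x+y]-[u+v]≈[x-u]+[y-v] x y u v = ≈-trans (+-cong ≈-refl (≈-sym (-‿+-comm u v))) (interchange x y (- u) (- v))

  private
    ballotTerm : Carrier × Ballot n → Pol
    ballotTerm x = term (proj₁ x) (toExp (proj₁ (proj₂ x)))

  ballotSum-toExp : ∀ cs S → sumP (List.map ballotTerm cs) (toExp S) ≈ ballotCombination cs S
  ballotSum-toExp cs S = ≈-trans (≈-reflexive (sumP-apply cs ballotTerm (toExp S)))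
    (∑-cong cs (λ x → *-cong ≈-refl (≈-reflexive (mono-toExp (proj₁ (proj₂ x)) S))))

  ballotSum-hasSquare : ∀ cs {m} → HasSquare m → sumP (List.map ballotTerm cs) m ≈ 0#
  ballotSum-hasSquare cs {m} m-sq = ≈-trans (≈-reflexive (sumP-apply cs ballotTerm m))
    (∑-zero cs (λ x → ≈-trans (*-cong ≈-refl (mono-hasSquare m-sq (proj₁ (proj₂ x)))) (zeroʳ _)))

  module _ (char0 : CharZero K) where

    mono-ballotReduction : ∀ a → ∃[ b ] InSpanB b × InI (mono a -P b)
    mono-ballotReduction a with squareFree? a
    ... | inj₂ a-sq = 0P , linearCombination-zero _ ,
          inI-resp (λ m → ≈-trans (+-cong ≈-refl -0#≈0#) (≈-trans (+-identityʳ _) (≈-sym (*-identityˡ _))))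
                   (inI-hasSquare 1# a-sq)
    ... | inj₁ (T , refl) with basis-ballotReducible char0 T
    ...   | cs , g , T≈ = sumP (List.map ballotTerm cs) , (cs , λ m → ≈-refl) ,
            inI-resp (≈P-bySquareFreeness onSquareFree onSquares) (inI-lift-mulLinear g)
      where
      onSquareFree : ∀ S → mono (toExp T) (toExp S) - sumP (List.map ballotTerm cs) (toExp S)
                           ≈ lift (mulLinear g) (toExp S)
      onSquareFree S = begin
        mono (toExp T) (toExp S) - sumP (List.map ballotTerm cs) (toExp S)
          ≈⟨ +-cong (≈-reflexive (mono-toExp T S)) (-‿cong (ballotSum-toExp cs S)) ⟩
        basis T S - ballotCombination cs S                           ≈⟨ +-cong (T≈ S) ≈-refl ⟩
        (ballotCombination cs S + mulLinear g S) - ballotCombination cs S ≈⟨ xyx⁻¹≈y _ _ ⟩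
        mulLinear g S                                                ≈⟨ lift-toExp (mulLinear g) S ⟨
        lift (mulLinear g) (toExp S)                                 ∎
      onSquares : ∀ m → HasSquare m → mono (toExp T) m - sumP (List.map ballotTerm cs) m ≈ lift (mulLinear g) m
      onSquares m m-sq = begin
        mono (toExp T) m - sumP (List.map ballotTerm cs) m
          ≈⟨ +-cong (mono-hasSquare m-sq T) (-‿cong (ballotSum-hasSquare cs m-sq)) ⟩
        0# - 0#                                            ≈⟨ -‿inverseʳ 0# ⟩
        0#                                                 ≈⟨ lift-hasSquare (mulLinear g) m-sq ⟨
        lift (mulLinear g) m                               ∎

    terms-ballotReduction : ∀ ts → ∃[ b ] InSpanB b × InI (sumP (List.map monomialTerm ts) -P b)
    terms-ballotReduction [] = 0P , linearCombination-zero _ , inI-zero (λ m → -‿inverseʳ 0#)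
    terms-ballotReduction ((a , v) ∷ ts) with mono-ballotReduction v | terms-ballotReduction ts
    ... | b₁ , b₁∈B , v-b₁∈I | b₂ , b₂∈B , ts-b₂∈I =
      (a ·P b₁) +P b₂ ,
      linearCombination-+ _ (linearCombination-*ˡ _ a b₁∈B) b₂∈B ,
      inI-resp (λ m → ≈-trans ([x+y]-[u+v]≈[x-u]+[y-v] _ _ _ _) (+-cong (≈-sym (x[y-z]≈xy-xz a _ _)) ≈-refl))
               (inI-+ (inI-*ˡ a v-b₁∈I) ts-b₂∈I)

    ballotSpan-modI : ∀ p → IsPoly p → ∃[ b ] InSpanB b × InI (p -P b)
    ballotSpan-modI p (ts , p≈) with terms-ballotReduction ts
    ... | b , b∈B , ts-b∈I = b , b∈B , inI-resp (λ m → +-cong (p≈ m) ≈-refl) ts-b∈I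

module LeadingMonomials {c ℓ} (K : Field c ℓ) where
  open Field K hiding (zero) renaming (refl to ≈-refl; sym to ≈-sym; trans to ≈-trans; reflexive to ≈-reflexive)
  open module PolyK {k : ℕ} = Poly K k using (Mon; mono; toExp; _∣M_; LM)
  open Bitstrings
  open SquareFreeQuotient K using (𝟙)
  open MonomialArithmetic K using (replicate-0-∣M)

  <L-irrefl : ∀ {k} (a : Mon {k}) → ¬ (a <L a)
  <L-irrefl (x ∷ a) (inj₁ x<x) = ℕP.<-irrefl refl x<x
  <L-irrefl (x ∷ a) (inj₂ (_ , a<a)) = <L-irrefl a a<a

  <L-trans : ∀ {k} {a b d : Mon {k}} → a <L b → b <L d → a <L d
  <L-trans {a = []} {[]} {[]} () _
  <L-trans {a = _ ∷ _} {_ ∷ _} {_ ∷ _} (inj₁ x<y) (inj₁ y<z) = inj₁ (ℕP.<-trans x<y y<z)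
  <L-trans {a = _ ∷ _} {_ ∷ _} {_ ∷ _} (inj₁ x<y) (inj₂ (refl , _)) = inj₁ x<y
  <L-trans {a = _ ∷ _} {_ ∷ _} {_ ∷ _} (inj₂ (refl , _)) (inj₁ y<z) = inj₁ y<z
  <L-trans {a = _ ∷ _} {_ ∷ _} {_ ∷ _} (inj₂ (refl , a<b)) (inj₂ (refl , b<d)) = inj₂ (refl , <L-trans a<b b<d)

  <L⇒≢ : ∀ {k} {a b : Mon {k}} → a <L b → b ≢ a
  <L⇒≢ a<a refl = <L-irrefl _ a<a

  mono-self : ∀ {k} (a : Mon {k}) → mono a a ≈ 1#
  mono-self a = ≈-reflexive (≡.cong 𝟙 (dec-true (≡-dec ℕP._≟_ a a) refl))

  mono-≢ : ∀ {k} (a m : Mon {k}) → m ≢ a → mono a m ≈ 0#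
  mono-≢ a m m≢a = ≈-reflexive (≡.cong 𝟙 (dec-false (≡-dec ℕP._≟_ m a) m≢a))

  LM-mono : ∀ {k} (a : Mon {k}) → LM (mono a) a
  LM-mono a = (λ a≈0 → 1≉0 (≈-trans (≈-sym (mono-self a)) a≈0)) , λ m a<m → mono-≢ a m (<L⇒≢ a<m)

  toExp-injective : ∀ {k} (S T : Vec Bool k) → toExp S ≡ toExp T → S ≡ T
  toExp-injective [] [] _ = refl
  toExp-injective (false ∷ S) (false ∷ T) eq = ≡.cong (false ∷_) (toExp-injective S T (VecP.∷-injectiveʳ eq))
  toExp-injective (true ∷ S) (true ∷ T) eq = ≡.cong (true ∷_) (toExp-injective S T (VecP.∷-injectiveʳ eq))
  toExp-injective (false ∷ S) (true ∷ T) ()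
  toExp-injective (true ∷ S) (false ∷ T) ()

  toExp-replicate-false-∣M : ∀ {k} (m : Mon {k}) → toExp (Vec.replicate k false) ∣M m
  toExp-replicate-false-∣M {k} m = ≡.subst (_∣M m) (≡.sym (VecP.map-replicate _ false k)) (replicate-0-∣M m)

  toExp-keepPrefix-∣M : ∀ {k} j (T : Vec Bool k) → toExp (keepPrefix j T) ∣M toExp T
  toExp-keepPrefix-∣M zero T = toExp-replicate-false-∣M _
  toExp-keepPrefix-∣M (suc j) [] = PW.[]
  toExp-keepPrefix-∣M (suc j) (t ∷ T) = ℕP.≤-refl PW.∷ toExp-keepPrefix-∣M j T

  <L-ofSupportedBy : ∀ {k} (α β : Vec Bool k) u m → Vec.toList α ≡ u ++ replicateL m false →
    (∀ i → suc (Fin.toℕ i) ≤ List.length u → Vec.lookup α i ≡ false → Vec.lookup β i ≡ false) →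
    ones (Vec.toList β) ≡ ones (Vec.toList α) → β ≢ α → toExp β <L toExp α
  <L-ofSupportedBy α β [] m α≡0ᵐ _ sameOnes β≢α =
    ⊥-elim (β≢α (≡.trans (ones≡0⇒replicate-false β (≡.trans sameOnes noOnes))
                         (≡.sym (ones≡0⇒replicate-false α noOnes))))
    where noOnes = ≡.trans (≡.cong ones α≡0ᵐ) (ones-replicate-false m)
  <L-ofSupportedBy (a ∷ α) (b ∷ β) (x ∷ u) m eq supp sameOnes β≢α with ListP.∷-injective eq
  <L-ofSupportedBy (false ∷ α) (b ∷ β) (false ∷ u) m eq supp sameOnes β≢α | refl , eq′ with supp Fin.zero (s≤s z≤n) refl
  ... | refl =
    inj₂ (refl , <L-ofSupportedBy α β u m eq′ (λ i → supp (Fin.suc i) ∘ s≤s) sameOnes (β≢α ∘ ≡.cong (false ∷_)))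
  <L-ofSupportedBy (true ∷ α) (true ∷ β) (true ∷ u) m eq supp sameOnes β≢α | refl , eq′ =
    inj₂ (refl , <L-ofSupportedBy α β u m eq′ (λ i → supp (Fin.suc i) ∘ s≤s) (ℕP.suc-injective sameOnes)
                                  (β≢α ∘ ≡.cong (true ∷_)))
  <L-ofSupportedBy (true ∷ α) (false ∷ β) (true ∷ u) m eq supp sameOnes β≢α | refl , eq′ = inj₁ (s≤s z≤n)

module DivisionRemainders {c ℓ} (K : Field c ℓ) (n′ : ℕ) where
  open Field K hiding (zero) renaming (refl to ≈-refl; sym to ≈-sym; trans to ≈-trans; reflexive to ≈-reflexive)
  open Poly K (suc n′)
  open Bitstrings
  open FiniteSums K using (∑-filter-zero)
  open MonomialArithmetic K using (square-at; squareFree?; square-∣M)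
  open LeadingMonomials K
  open QuotientRing K (suc n′) using (sumP-apply; linearCombination-zero; linearCombination-+)
  open import Relation.Binary.Construct.Closure.ReflexiveTransitive using (Star; ε; _◅_)

  mcp-support : ∀ {α} → IsMCP α →
    ∃[ u ] ∃[ m ] Vec.toList α ≡ u ++ replicateL m false × List.length u ≡ 2 ℕ.* ℓ₁ α ∸ 1
  mcp-support {α} (w , m , α≡w10ᵐ , balanced , _) =
    w ++ true ∷ [] , m , ≡.trans α≡w10ᵐ (≡.sym (ListP.++-assoc w (true ∷ []) _)) , length-w1
    where
    open ≡.≡-Reasoning
    o = ones w
    ℓ₁α≡ : ℓ₁ α ≡ suc o
    ℓ₁α≡ = ≡.trans (≡.cong ones α≡w10ᵐ) (ones-[w1]++replicate-false w m)
    length-w1 : List.length (w ++ true ∷ []) ≡ 2 ℕ.* ℓ₁ α ∸ 1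
    length-w1 = begin
      List.length (w ++ true ∷ []) ≡⟨ ListP.length-++ w ⟩
      List.length w +ℕ 1           ≡⟨ ℕP.+-comm (List.length w) 1 ⟩
      suc (List.length w)          ≡⟨ ≡.cong suc (length-balanced w balanced) ⟩
      suc (2 ℕ.* o)                ≡⟨ ℕP.+-suc o (o +ℕ 0) ⟨
      2 ℕ.* suc o ∸ 1              ≡⟨ ≡.cong (λ z → 2 ℕ.* z ∸ 1) ℓ₁α≡ ⟨
      2 ℕ.* ℓ₁ α ∸ 1               ∎

  P⇒<L : ∀ {α β} → IsMCP α → P α β → toExp β <L toExp α
  P⇒<L {α} {β} α-mcp (β≢α , sameOnes , supp) with mcp-support α-mcp
  ... | u , m , α≡u0ᵐ , |u| =
    <L-ofSupportedBy α β u m α≡u0ᵐ (λ i i<|u| → supp i (≡.subst (suc (Fin.toℕ i) ≤_) |u| i<|u|)) sameOnes β≢α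

  ∑P-vanishes : ∀ α m → (∀ β → P α β → mono (toExp β) m ≈ 0#) →
                sumP (List.map (λ β → mono (toExp β)) (List.filter (P? α) (allBits (suc n′)))) m ≈ 0#
  ∑P-vanishes α m vanish =
    ≈-trans (≈-reflexive (sumP-apply (List.filter (P? α) (allBits (suc n′))) (λ β → mono (toExp β)) m))
            (∑-filter-zero (P? α) (λ β → mono (toExp β) m) (allBits (suc n′)) vanish)

  LM-g : ∀ α → IsMCP α → LM (g α) (toExp α)
  LM-g α α-mcp = (λ gα≈0 → 1≉0 (≈-trans (≈-sym g-at-α) gα≈0)) , λ m α<m →
    ≈-trans (+-cong (mono-≢ (toExp α) m (<L⇒≢ α<m))
                    (∑P-vanishes α m (λ β β∈P → mono-≢ (toExp β) m (<L⇒≢ (<L-trans (P⇒<L α-mcp β∈P) α<m)))))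
            (+-identityʳ 0#)
    where
    g-at-α : g α (toExp α) ≈ 1#
    g-at-α = ≈-trans (+-cong (mono-self (toExp α))
                             (∑P-vanishes α (toExp α) (λ β β∈P → mono-≢ (toExp β) (toExp α)
                               (λ β≡α → proj₁ β∈P (≡.sym (toExp-injective α β β≡α))))))
                     (+-identityʳ 1#)

  firstVariable : Vec Bool (suc n′)
  firstVariable = true ∷ Vec.replicate n′ false

  firstVariable-mcp : IsMCP firstVariable
  firstVariable-mcp = [] , n′ , ≡.cong (true ∷_) (toList-replicate-false n′) , refl , staysAboveFrom0⇒staysAbove [] tt

  ℓ₁-firstVariable : ℓ₁ firstVariable ≡ 1
  ℓ₁-firstVariable = ≡.cong suc (≡.trans (≡.cong ones (toList-replicate-false n′)) (ones-replicate-false n′))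

  -- 2 · ones w = |w| ≤ n′ at a first descent w1 of a bitstring of length n′ + 1
  ones≤half-atDescent : ∀ (γ : Vec Bool (suc n′)) w v → Vec.toList γ ≡ w ++ true ∷ v → zeros w ≡ ones w →
                        ones w ≤ n′ / 2
  ones≤half-atDescent γ w v γ≡w1v balanced =
    ≡.subst (_≤ n′ / 2) (m*n/n≡m (ones w) 2) (/-monoˡ-≤ 2 2o≤n′)
    where
    open import Data.Nat.DivMod using (m*n/n≡m; /-monoˡ-≤)
    |w|+|v|≡n′ : List.length w +ℕ List.length v ≡ n′
    |w|+|v|≡n′ = ℕP.suc-injective (≡.trans (≡.sym (ℕP.+-suc _ _)) (≡.trans (≡.sym (ListP.length-++ w))
                   (≡.trans (≡.cong List.length (≡.sym γ≡w1v)) (VecP.length-toList γ))))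
    2o≤n′ : ones w ℕ.* 2 ≤ n′
    2o≤n′ = ≡.subst₂ _≤_ (≡.trans (length-balanced w balanced) (ℕP.*-comm 2 (ones w))) |w|+|v|≡n′ (ℕP.m≤m+n _ _)

  Irreducible : ℕ → Mon → Set (c ⊔ ℓ)
  Irreducible l m = ∀ f m′ → InF l f → LM f m′ → ¬ (m′ ∣M m)

  -- y^m is divisible by y₁ = LM(g_{1 0…0}), by some y_i² with i ≥ 2, or by y^α for the MCP α ending at the
  -- first descent of m; the bound on l makes that g_α a member of F_l.
  irreducible⇒ballot : ∀ {l} → n′ / 2 ≤ l → ∀ m → Irreducible l m → Σ BElt (λ γ → m ≡ toExp (proj₁ γ))
  irreducible⇒ballot {l} half≤l (x ∷ m) irred with squareFree? (x ∷ m)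
  ... | inj₂ (square-at Fin.zero 2≤x) = ⊥-elim (irred (g firstVariable) _
        (mcp firstVariable firstVariable-mcp (≡.subst (_≤ suc l) (≡.sym ℓ₁-firstVariable) (s≤s z≤n)))
        (LM-g firstVariable firstVariable-mcp) (ℕP.≤-trans (s≤s z≤n) 2≤x PW.∷ toExp-replicate-false-∣M m))
  ... | inj₂ (square-at (Fin.suc i) 2≤mᵢ) =
        ⊥-elim (irred (ysq (Fin.suc i)) _ (sq (Fin.suc i) (s≤s z≤n)) (LM-mono _) (square-∣M (x ∷ m) (Fin.suc i) 2≤mᵢ))
  ... | inj₁ (γ , x∷m≡γ) with staysAboveFrom? 0 (Vec.toList γ)
  ...   | inj₁ above = (γ , staysAboveFrom0⇒staysAbove _ above) , x∷m≡γ
  ...   | inj₂ (w , v , γ≡w1v , balanced , w-above) =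
    ⊥-elim (irred (g α) (toExp α) (mcp α α-mcp ℓ₁α≤) (LM-g α α-mcp)
                  (≡.subst (toExp α ∣M_) (≡.sym x∷m≡γ) (toExp-keepPrefix-∣M (suc (List.length w)) γ)))
    where
    α = keepPrefix (suc (List.length w)) γ
    balanced′ : zeros w ≡ ones w
    balanced′ = ≡.trans (≡.sym (ℕP.+-identityʳ _)) balanced
    α-mcp : IsMCP α
    α-mcp = w , List.length v , toList-keepPrefix w v γ γ≡w1v , balanced′ , staysAboveFrom0⇒staysAbove w w-above
    ℓ₁α≤ : ℓ₁ α ≤ suc l
    ℓ₁α≤ = ≡.subst (_≤ suc l)
             (≡.sym (≡.trans (≡.cong ones (toList-keepPrefix w v γ γ≡w1v)) (ones-[w1]++replicate-false w _)))
             (s≤s (ℕP.≤-trans (ones≤half-atDescent γ w v γ≡w1v balanced′) half≤l))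

  -- Only the toRem step changes the remainder, and it adds a term whose monomial is irreducible.
  remainder-inSpanB : ∀ {l} → n′ / 2 ≤ l → ∀ p r → IsRemainder (InF l) p r → InSpanB r
  remainder-inSpanB {l} half≤l p r (_ , run , _) = preserve run (linearCombination-zero ballotExp)
    where
    ballotExp : BElt → Mon
    ballotExp γ = toExp (proj₁ γ)
    step-preserve : ∀ {s s′} → Step (InF l) s s′ → InSpanB (proj₂ s) → InSpanB (proj₂ s′)
    step-preserve (divide _ _ _ _ _) r∈B = r∈B
    step-preserve (toRem {p = p} {m = m} _ irred) r∈B with irreducible⇒ballot half≤l m irred
    ... | γ , refl = linearCombination-+ ballotExp r∈B (((p m , γ) ∷ []) , λ _ → ≈-sym (+-identityʳ _))
    preserve : ∀ {s s′} → Star (Step (InF l)) s s′ → InSpanB (proj₂ s) → InSpanB (proj₂ s′)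
    preserve ε r∈B = r∈B
    preserve (step ◅ steps) r∈B = preserve steps (step-preserve step r∈B)

lemma2p8 : ∀ {c ℓ : Level} (K : Field c ℓ) → CharZero K → (n : ℕ) → 3 ≤ n →
    let open Poly K n in
    (∀ (δ : Mon) (r : Pol) → IsRemainder (InF ((n ∸ 1) / 2)) (mono δ) r → InSpanB r)
    × (∀ (p : Pol) → IsPoly p → ∃[ b ] (InSpanB b × InIdeal GenI (p -P b)))
-- The argument works for every n ≥ 1; 3 ≤ n only rules out n = 0.
lemma2p8 K char0 zero ()
lemma2p8 K char0 (suc n′) _ =
  (λ δ → DivisionRemainders.remainder-inSpanB K n′ ℕP.≤-refl (Poly.mono K (suc n′) δ)) ,
  QuotientRing.ballotSpan-modI K (suc n′) char0
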